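{- Let $D$ be a delta-matroid on $[n,\overline n]$. Then $$U_D(u,v-1)=\sum_{I\text{ independent in }D}u^{n-|I|}v^{a(I)}.$$
   Context: Let $[n,\overline{n}]=\{1,\dots,n,\overline{1},\dots,\overline{n}\}$ with involution $a\mapsto\overline a$; $\overline S=\{\overline a:a\in S\}$. Admissible sets contain at most one of $i,\overline i$ for each $i$; $\operatorname{AdS}_n$ is their set. For $E\subseteq[n]$, a delta-matroid on $E\cup\overline E$ is a non-empty collection $\mathcal F$ of admissible subsets of $E\cup\overline E$ of size $|E|$ (feasible sets) such that $\operatorname{Conv}\{e_B:B\in\mathcal F\}\subseteq\mathbb{R}^E$ has all edges parallel to some $e_i$ or $e_i\pm e_j$, where $e_{\overline i}=-e_i$ and $e_S=\sum_{a\in S}e_a$. Rank function: $g_D(S)=\max_{B\in\mathcal F}(|S\cap B|-|\overline S\cap B|)$. $U_D(u,v)=\sum_{S\in\operatorname{AdS}_n}u^{n-|S|}v^{(|S|-g_D(S))/2}$. For $A\subseteq[n]$, the projection $D(A)$ is the delta-matroid on $([n]\setminus A)\cup\overline{([n]\setminus A)}$ with feasible sets $B\setminus(A\cup\overline A)$, $B\in\mathcal F$. An admissible set $I$ is independent in $D$ if contained in a feasible set. Use the order $1<2<\dots<n$. For a feasible set $B$ of a delta-matroid $D'$, $i$ is $B$-orientable if $B\,\Delta\,\{i,\overline i\}$ is not feasible in $D'$, and $i$ is $B$-active if it is $B$-orientable and there is no $j<i$ with $B\,\Delta\,\{i,j,\overline i,\overline j\}$ feasible in $D'$ ($\Delta$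 = symmetric difference). For $I$ independent in $D$ let $\underline I=\{i\in[n]: i\in I\text{ or }\overline i\in I\}$; $I$ is feasible in $D([n]\setminus\underline I)$, and $i\in\underline I$ is $I$-active if it is $I$-active in $D([n]\setminus\underline I)$. $a(I)$ is the number of $I$-active elements of $\underline I$. -}

module Defs where

open import Data.Bool using (Bool; true; false; not; _∧_; _∨_; if_then_else_)
open import Data.Maybe using (Maybe; just; nothing)
import Data.Maybe as Maybe
open import Data.Nat using (ℕ; zero; suc; _∸_; _<_) renaming (_/_ to _div_)
open import Data.Integer using (ℤ; +_; _*_; _+_; _-_; -_; _⊔_; ∣_∣; _^_; _≤_)
open import Data.Fin using (Fin; toℕ)
open import Data.Vec using (Vec; []; _∷_; lookup; updateAt; map; zipWith; foldr; tabulate; allFin)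
import Data.Vec as Vec
open import Data.List using (List; []; _∷_; concatMap; filter; length)
open import Data.Bool.ListAction using (any)
import Data.List as List
open import Data.Product using (Σ; ∃; ∃-syntax; _×_; _,_)
open import Data.Sum using (_⊎_)
open import Relation.Binary.PropositionalEquality using (_≡_; _≢_)
open import Relation.Nullary using (¬_)
open import Relation.Nullary.Decidable using (does)
open import Data.Nat using (_<?_)

-- The element i ∈ [n] is (i , true), the element ī is (i , false).
-- An ADMISSIBLE set S ⊆ [n, n̄] (at most one of i, ī) is encoded as
--   S : Vec (Maybe Bool) n,  S[i] = nothing  (neither i nor ī in S),
--                            S[i] = just true (i ∈ S), just false (ī ∈ S).
-- An admissible set of size n (a candidate feasible set of a delta-matroid
-- on [n, n̄]) contains exactly one of i, ī for each i, and is encoded as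
--   B : Vec Bool n.

AdS : ℕ → Set
AdS n = Vec (Maybe Bool) n

Full : ℕ → Set
Full n = Vec Bool n

full→ads : ∀ {n} → Full n → AdS n
full→ads = map just

card : ∀ {n} → AdS n → ℕ
card = foldr _ (λ { nothing k → k ; (just _) k → suc k }) 0

allVecs : ∀ {A : Set} → List A → (n : ℕ) → List (Vec A n)
allVecs xs zero    = [] ∷ []
allVecs xs (suc n) = concatMap (λ x → List.map (x ∷_) (allVecs xs n)) xs

allAdS : (n : ℕ) → List (AdS n)
allAdS = allVecs (nothing ∷ just false ∷ just true ∷ [])

allFull : (n : ℕ) → List (Full n)
allFull = allVecs (false ∷ true ∷ [])

-- Geometry: e_B ∈ ℤ^n with e_i = standard vector, e_ī = - e_i.

sgn : Bool → ℤ
sgn true  = + 1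
sgn false = - (+ 1)

eVec : ∀ {n} → Full n → Vec ℤ n
eVec = map sgn

dot : ∀ {n} → Vec ℤ n → Vec ℤ n → ℤ
dot c x = foldr _ _+_ (+ 0) (zipWith _*_ c x)

unit : ∀ {n} → Fin n → Vec ℤ n
unit {n} i = tabulate λ k → if does (toℕ k Data.Nat.≟ toℕ i) then + 1 else + 0

IsRootDirection : ∀ {n} → Vec ℤ n → Set
IsRootDirection {n} w =
  (∃[ i ] w ≡ unit i)
  ⊎ (∃[ i ] ∃[ j ] (i ≢ j × w ≡ zipWith _+_ (unit i) (unit j)))
  ⊎ (∃[ i ] ∃[ j ] (i ≢ j × w ≡ zipWith _-_ (unit i) (unit j)))

Parallel : ∀ {n} → Vec ℤ n → Vec ℤ n → Set
Parallel d w = ∃[ p ] ∃[ q ] (p ≢ + 0 × q ≢ + 0 × map (p *_) d ≡ map (q *_) w)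

-- Every e_B is a vertex of the
-- cube [-1,1]^n, hence a vertex of the polytope, and the face exposed by a
-- linear functional c is the convex hull of the maximisers of c.  So the
-- segment is an edge iff some functional c (rational, equivalently after
-- scaling integral, since the polytope is rational) is maximised on the
-- feasible sets exactly at B and B' (B ≠ B').
IsEdge : ∀ {n} → (Full n → Bool) → Full n → Full n → Set
IsEdge {n} F B B' =
  F B ≡ true × F B' ≡ true × B ≢ B' ×
  ∃[ c ] ( (∀ B'' → F B'' ≡ true → dot c (eVec B'') ≤ dot c (eVec B))
         × dot c (eVec B') ≡ dot c (eVec B)
         × (∀ B'' → F B'' ≡ true → dot c (eVec B'') ≡ dot c (eVec B) →
              B'' ≡ B ⊎ B'' ≡ B') )

record DeltaMatroid (n : ℕ) : Set where
  field
    feasible : Full n → Bool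
    nonempty : ∃[ B ] feasible B ≡ true
    edges    : ∀ B B' → IsEdge feasible B B' →
               ∃[ w ] (IsRootDirection w × Parallel (zipWith _-_ (eVec B) (eVec B')) w)

open DeltaMatroid public

-- |S ∩ B| - |S̄ ∩ B|
signedMeet : ∀ {n} → AdS n → Full n → ℤ
signedMeet [] [] = + 0
signedMeet (nothing ∷ S) (b ∷ B) = signedMeet S B
signedMeet (just s ∷ S) (b ∷ B) =
  (if does (Data.Bool._≟_ s b) then + 1 else - (+ 1)) + signedMeet S B

-- g_D(S) = max_{B ∈ F} (|S ∩ B| - |S̄ ∩ B|).  The fold starts at -|S|, which
-- is a lower bound of every term; as F ≠ ∅ this is the maximum over F.
rank : ∀ {n} → DeltaMatroid n → AdS n → ℤ
rank {n} D S =
  List.foldr (λ B m → signedMeet S B ⊔ m) (- (+ card S))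
             (filter (λ B → Data.Bool._≟_ (feasible D B) true) (allFull n))

-- (|S| - g_D(S)) / 2   (|S| - g_D(S) is a non-negative even integer)
uExp : ∀ {n} → DeltaMatroid n → AdS n → ℕ
uExp D S = ∣ + card S - rank D S ∣ div 2

sumℤ : List ℤ → ℤ
sumℤ = List.foldr _+_ (+ 0)

U : ∀ {n} → DeltaMatroid n → ℤ → ℤ → ℤ
U {n} D u w = sumℤ (List.map (λ S → u ^ (n ∸ card S) * w ^ uExp D S) (allAdS n))

subsetB : ∀ {n} → AdS n → Full n → Bool
subsetB [] [] = true
subsetB (nothing ∷ I) (b ∷ B) = subsetB I B
subsetB (just s ∷ I) (b ∷ B) = does (Data.Bool._≟_ s b) ∧ subsetB I B

independent : ∀ {n} → DeltaMatroid n → AdS n → Bool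
independent {n} D I = any (λ B → feasible D B ∧ subsetB I B) (allFull n)

inSupport : ∀ {n} → AdS n → Fin n → Bool
inSupport I i with lookup I i
... | nothing = false
... | just _  = true

-- B \ (A ∪ Ā) for A = [n] \ I̲ : keep exactly the coordinates in I̲
restrictTo : ∀ {n} → AdS n → Full n → AdS n
restrictTo [] [] = []
restrictTo (nothing ∷ I) (b ∷ B) = nothing ∷ restrictTo I B
restrictTo (just _ ∷ I) (b ∷ B) = just b ∷ restrictTo I B

eqMB : Maybe Bool → Maybe Bool → Bool
eqMB nothing nothing = true
eqMB (just a) (just b) = does (Data.Bool._≟_ a b)
eqMB _ _ = false

eqAdS : ∀ {n} → AdS n → AdS n → Bool
eqAdS [] [] = true
eqAdS (x ∷ X) (y ∷ Y) = eqMB x y ∧ eqAdS X Y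

-- X is feasible in the projection D([n] \ I̲), whose feasible sets are
-- B \ (([n] \ I̲) ∪ overline([n] \ I̲)) for B ∈ F.
feasibleInProj : ∀ {n} → DeltaMatroid n → AdS n → AdS n → Bool
feasibleInProj {n} D I X =
  any (λ B → feasible D B ∧ eqAdS (restrictTo I B) X) (allFull n)

-- X Δ {i, ī} for X containing exactly one of i, ī
swap : ∀ {n} → AdS n → Fin n → AdS n
swap X i = updateAt X i (Maybe.map not)

orientable : ∀ {n} → DeltaMatroid n → AdS n → Fin n → Bool
orientable D I i = not (feasibleInProj D I (swap I i))

-- Only j ∈ I̲ need be considered: for j ∉ I̲ the set
-- I Δ {i,j,ī,j̄} contains both j and j̄, so is not admissible, hence not feasible.
active : ∀ {n} → DeltaMatroid n → AdS n → Fin n → Bool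
active {n} D I i =
  inSupport I i ∧ orientable D I i ∧
  not (any (λ j → does (toℕ j <? toℕ i) ∧ inSupport I j ∧
                       feasibleInProj D I (swap (swap I i) j))
                (Vec.toList (allFin n)))

activity : ∀ {n} → DeltaMatroid n → AdS n → ℕ
activity {n} D I = length (filter (λ i → Data.Bool._≟_ (active D I i) true) (Vec.toList (allFin n)))

activitySum : ∀ {n} → DeltaMatroid n → ℤ → ℤ → ℤ
activitySum {n} D u v =
  sumℤ (List.map (λ I → u ^ (n ∸ card I) * v ^ activity D I)
                (filter (λ I → Data.Bool._≟_ (independent D I) true) (allAdS n)))

-- First, the edge condition on the polytope gives the symmetric exchange axiom: if A, C
-- are feasible and x ∈ A Δ C, then A Δ {x, x̄} or A Δ {x, x̄, y, ȳ} is feasible for some y ≠ x in A Δ C.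
-- Take a feasible B′ differing from A at x with A Δ B′ ⊆ A Δ C, as close to A as possible; a weighted linear
-- functional is maximised over the feasible sets exactly at A and B′, so [e_A, e_B′] is an edge, its
-- direction is e_i or e_i ± e_j, and B′ differs from A in at most two coordinates.
-- Second, for every non-empty family with symmetric exchange, both sides obey the same recursion in the
-- largest element n.  The terms with n ∉ S̲ give u times the expansion of the projection D({n}).  If both
-- fibres over n are non-empty, the terms containing n or n̄ give the expansions of the two fibres, and n is
-- never active since exchange flips it alone or with a smaller y.  If only one fibre is non-empty, those
-- terms give U + (v - 1) U for the projection, while n is always active, giving v times its activity sum.

module Submission where

open import Defs
open import Data.Nat using (ℕ)
open import Data.Integer using (ℤ; _-_; +_)
open import Relation.Binary.PropositionalEquality using (_≡_)

open import Data.Bool as Bool using (Bool; true; false; not; _∧_; _∨_; if_then_else_)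
import Data.Bool.Properties as BP
open import Data.Bool.ListAction using (any)
open import Data.Empty using (⊥; ⊥-elim)
open import Data.Fin as Fin using (Fin; toℕ; inject₁; fromℕ)
import Data.Fin.Properties as FP
open import Data.Integer using (_+_; _*_; -_; _^_; _⊔_)
import Data.Integer as Z
import Data.Integer.Properties as ZP
open import Data.Integer.Tactic.RingSolver using (solve-∀)
open import Data.List as List using (List; []; _∷_; _++_; filter; length)
open import Data.List.Membership.Propositional using (_∈_)
open import Data.List.Membership.Propositional.Properties using (∈-map⁺; ∈-concatMap⁺; ∈-filter⁺; ∈-filter⁻)
import Data.List.Relation.Unary.All as All
open import Data.List.Relation.Unary.All.Properties using (all-filter)
open import Data.List.Extrema.Nat using (argmin; argmin-all; f[argmin]≤f[xs])
open import Data.List.Relation.Unary.Any as Any using (here; there)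
open import Data.Maybe as Maybe using (Maybe; just; nothing)
import Data.Nat as N
import Data.Nat.DivMod as DM
import Data.Nat.Properties as NP
open import Algebra.Properties.CommutativeSemigroup NP.+-commutativeSemigroup using () renaming (interchange to +-interchange)
open import Data.Product using (∃-syntax; _×_; _,_; proj₁; proj₂)
open import Data.Sum using (_⊎_; inj₁; inj₂; [_,_]′)
open import Data.Vec as Vec using (Vec; []; _∷_; _∷ʳ_; lookup; updateAt; tabulate; allFin)
open import Data.Vec.Membership.Propositional.Properties using (∈-toList⁺; ∈-allFin⁺)
import Data.Vec.Properties as VP
open import Relation.Binary.PropositionalEquality using (refl; sym; trans; cong; cong₂; subst; subst₂; _≢_; module ≡-Reasoning)
open import Relation.Nullary using (yes; no; does)
import Relation.Nullary.Decidable as Dec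

open ≡-Reasoning

-- The recursion passes to fibres and projections, which are only known to have symmetric exchange, so the
-- notions of Defs are restated for arbitrary families of full sets; for feasible D they unfold to the originals.
Family : ℕ → Set
Family n = Full n → Bool

Nonempty : ∀ {n} → Family n → Set
Nonempty F = ∃[ B ] F B ≡ true

Empty : ∀ {n} → Family n → Set
Empty F = ∀ B → F B ≡ true → ⊥

rankF : ∀ {n} → Family n → AdS n → ℤ
rankF {n} F S =
  List.foldr (λ B m → signedMeet S B ⊔ m) (- (+ card S))
             (filter (λ B → Bool._≟_ (F B) true) (allFull n))

uExpF : ∀ {n} → Family n → AdS n → ℕ
uExpF F S = Z.∣ + card S - rankF F S ∣ N./ 2

independentF : ∀ {n} → Family n → AdS n → Bool
independentF {n} F I = any (λ B → F B ∧ subsetB I B) (allFull n)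

feasibleInProjF : ∀ {n} → Family n → AdS n → AdS n → Bool
feasibleInProjF {n} F I X = any (λ B → F B ∧ eqAdS (restrictTo I B) X) (allFull n)

activeF : ∀ {n} → Family n → AdS n → Fin n → Bool
activeF {n} F I i =
  inSupport I i ∧ not (feasibleInProjF F I (swap I i)) ∧
  not (any (λ j → does (toℕ j N.<? toℕ i) ∧ inSupport I j ∧
                       feasibleInProjF F I (swap (swap I i) j))
                (Vec.toList (allFin n)))

count : ∀ n → (Fin n → Bool) → ℕ
count n h = length (filter (λ i → Bool._≟_ (h i) true) (Vec.toList (allFin n)))

activityF : ∀ {n} → Family n → AdS n → ℕ
activityF F I = count _ (activeF F I)

∧-true⁻ : ∀ {a b} → a ∧ b ≡ true → a ≡ true × b ≡ true
∧-true⁻ {true} {true} _ = refl , refl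

∧-true⁺ : ∀ {a b} → a ≡ true → b ≡ true → a ∧ b ≡ true
∧-true⁺ refl refl = refl

∨-true⁻ : ∀ {a b} → a ∨ b ≡ true → a ≡ true ⊎ b ≡ true
∨-true⁻ {true}  _ = inj₁ refl
∨-true⁻ {false} e = inj₂ e

∨-trueˡ : ∀ {a} b → a ≡ true → a ∨ b ≡ true
∨-trueˡ b refl = refl

∨-trueʳ : ∀ a {b} → b ≡ true → a ∨ b ≡ true
∨-trueʳ true  _ = refl
∨-trueʳ false e = e

true≢false : true ≢ false
true≢false ()

≡-from-⇔ : ∀ {a b : Bool} → (a ≡ true → b ≡ true) → (b ≡ true → a ≡ true) → a ≡ b
≡-from-⇔ {true}  {true}  _ _ = refl
≡-from-⇔ {true}  {false} f _ = sym (f refl)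
≡-from-⇔ {false} {true}  _ g = g refl
≡-from-⇔ {false} {false} _ _ = refl

any-true⁺ : ∀ {A : Set} (p : A → Bool) {x xs} → x ∈ xs → p x ≡ true → any p xs ≡ true
any-true⁺ p (here refl)         px = ∨-trueˡ _ px
any-true⁺ p (there {x = y} x∈) px = ∨-trueʳ (p y) (any-true⁺ p x∈ px)

any-true⁻ : ∀ {A : Set} (p : A → Bool) xs → any p xs ≡ true → ∃[ x ] p x ≡ true
any-true⁻ p (x ∷ xs) e with ∨-true⁻ {p x} e
... | inj₁ px = x , px
... | inj₂ e′ = any-true⁻ p xs e′

any-false⁺ : ∀ {A : Set} (p : A → Bool) xs → (∀ x → p x ≡ true → ⊥) → any p xs ≡ false
any-false⁺ p []       _ = refl
any-false⁺ p (x ∷ xs) h with p x in px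
... | true  = ⊥-elim (h x px)
... | false = any-false⁺ p xs h

∈-allVecs : ∀ {A : Set} {xs : List A} → (∀ a → a ∈ xs) → ∀ {n} (V : Vec A n) → V ∈ allVecs xs n
∈-allVecs every []      = here refl
∈-allVecs every (a ∷ V) = ∈-concatMap⁺ _ (Any.map (λ { refl → ∈-map⁺ (a ∷_) (∈-allVecs every V) }) (every a))

∈-allFull : ∀ {n} (B : Full n) → B ∈ allFull n
∈-allFull = ∈-allVecs λ { false → here refl ; true → there (here refl) }

∈-allFin : ∀ {n} (i : Fin n) → i ∈ Vec.toList (allFin n)
∈-allFin i = ∈-toList⁺ (∈-allFin⁺ i)

∑ : ∀ {A : Set} → List A → (A → ℤ) → ℤ
∑ xs f = sumℤ (List.map f xs)

∑-++ : ∀ {A : Set} (xs ys : List A) (f : A → ℤ) → ∑ (xs ++ ys) f ≡ ∑ xs f + ∑ ys f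
∑-++ []       ys f = sym (ZP.+-identityˡ _)
∑-++ (x ∷ xs) ys f = trans (cong (λ z → f x + z) (∑-++ xs ys f)) (sym (ZP.+-assoc (f x) _ _))

∑-map : ∀ {A B : Set} (xs : List A) (g : A → B) (f : B → ℤ) → ∑ (List.map g xs) f ≡ ∑ xs (λ x → f (g x))
∑-map []       g f = refl
∑-map (x ∷ xs) g f = cong (λ z → f (g x) + z) (∑-map xs g f)

∑-cong : ∀ {A : Set} (xs : List A) {f g : A → ℤ} → (∀ x → f x ≡ g x) → ∑ xs f ≡ ∑ xs g
∑-cong []       e = refl
∑-cong (x ∷ xs) e = cong₂ _+_ (e x) (∑-cong xs e)

∑-*ˡ : ∀ {A : Set} (xs : List A) c (f : A → ℤ) → ∑ xs (λ x → c * f x) ≡ c * ∑ xs f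
∑-*ˡ []       c f = sym (ZP.*-zeroʳ c)
∑-*ˡ (x ∷ xs) c f = trans (cong (λ z → c * f x + z) (∑-*ˡ xs c f)) (sym (ZP.*-distribˡ-+ c (f x) _))

∑-zero : ∀ {A : Set} (xs : List A) → ∑ xs (λ _ → + 0) ≡ + 0
∑-zero []       = refl
∑-zero (x ∷ xs) = trans (ZP.+-identityˡ _) (∑-zero xs)

∑-filter : ∀ {A : Set} (xs : List A) (p : A → Bool) (f : A → ℤ) →
  ∑ (filter (λ x → Bool._≟_ (p x) true) xs) f ≡ ∑ xs (λ x → if p x then f x else + 0)
∑-filter []       p f = refl
∑-filter (x ∷ xs) p f with p x
... | true  = cong (λ z → f x + z) (∑-filter xs p f)
... | false = trans (∑-filter xs p f) (sym (ZP.+-identityˡ _))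

∑ᴬ : ∀ n → (AdS n → ℤ) → ℤ
∑ᴬ n = ∑ (allAdS n)

∑ᴬ-∷ : ∀ n (f : AdS (N.suc n) → ℤ) →
  ∑ᴬ (N.suc n) f ≡ ∑ᴬ n (λ S → f (nothing ∷ S)) + (∑ᴬ n (λ S → f (just false ∷ S)) + ∑ᴬ n (λ S → f (just true ∷ S)))
∑ᴬ-∷ n f =
  begin
    ∑ (part nothing ++ (part (just false) ++ (part (just true) ++ []))) f
  ≡⟨ ∑-++ (part nothing) _ f ⟩
    ∑ (part nothing) f + ∑ (part (just false) ++ (part (just true) ++ [])) f
  ≡⟨ cong (λ z → ∑ (part nothing) f + z) (∑-++ (part (just false)) _ f) ⟩
    ∑ (part nothing) f + (∑ (part (just false)) f + ∑ (part (just true) ++ []) f)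
  ≡⟨ cong (λ z → ∑ (part nothing) f + (∑ (part (just false)) f + z)) (trans (∑-++ (part (just true)) [] f) (ZP.+-identityʳ _)) ⟩
    ∑ (part nothing) f + (∑ (part (just false)) f + ∑ (part (just true)) f)
  ≡⟨ cong₂ _+_ (∑-map (allAdS n) _ f) (cong₂ _+_ (∑-map (allAdS n) _ f) (∑-map (allAdS n) _ f)) ⟩
    ∑ᴬ n (λ S → f (nothing ∷ S)) + (∑ᴬ n (λ S → f (just false ∷ S)) + ∑ᴬ n (λ S → f (just true ∷ S)))
  ∎
  where
  part : Maybe Bool → List (AdS (N.suc n))
  part x = List.map (x ∷_) (allAdS n)

∑ᴬ-∷ʳ : ∀ n (f : AdS (N.suc n) → ℤ) →
  ∑ᴬ (N.suc n) f ≡ ∑ᴬ n (λ S → f (S ∷ʳ nothing)) + (∑ᴬ n (λ S → f (S ∷ʳ just false)) + ∑ᴬ n (λ S → f (S ∷ʳ just true)))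
∑ᴬ-∷ʳ N.zero f = padding (f (nothing ∷ [])) (f (just false ∷ [])) (f (just true ∷ []))
  where
  padding : ∀ a b c → a + (b + (c + + 0)) ≡ (a + + 0) + ((b + + 0) + (c + + 0))
  padding = solve-∀
∑ᴬ-∷ʳ (N.suc n) f =
  begin
    ∑ᴬ (N.suc (N.suc n)) f
  ≡⟨ ∑ᴬ-∷ (N.suc n) f ⟩
    ∑ᴬ (N.suc n) (λ S → f (nothing ∷ S)) + (∑ᴬ (N.suc n) (λ S → f (just false ∷ S)) + ∑ᴬ (N.suc n) (λ S → f (just true ∷ S)))
  ≡⟨ cong₂ _+_ (∑ᴬ-∷ʳ n _) (cong₂ _+_ (∑ᴬ-∷ʳ n _) (∑ᴬ-∷ʳ n _)) ⟩
    (g nothing nothing + (g nothing (just false) + g nothing (just true))) +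
    ((g (just false) nothing + (g (just false) (just false) + g (just false) (just true))) +
     (g (just true) nothing + (g (just true) (just false) + g (just true) (just true))))
  ≡⟨ transpose (g nothing nothing) (g nothing (just false)) (g nothing (just true))
               (g (just false) nothing) (g (just false) (just false)) (g (just false) (just true))
               (g (just true) nothing) (g (just true) (just false)) (g (just true) (just true)) ⟩
    (g nothing nothing + (g (just false) nothing + g (just true) nothing)) +
    ((g nothing (just false) + (g (just false) (just false) + g (just true) (just false))) +
     (g nothing (just true) + (g (just false) (just true) + g (just true) (just true))))
  ≡⟨ sym (cong₂ _+_ (∑ᴬ-∷ n _) (cong₂ _+_ (∑ᴬ-∷ n _) (∑ᴬ-∷ n _))) ⟩
    ∑ᴬ (N.suc n) (λ S → f (S ∷ʳ nothing)) + (∑ᴬ (N.suc n) (λ S → f (S ∷ʳ just false)) + ∑ᴬ (N.suc n) (λ S → f (S ∷ʳ just true)))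
  ∎
  where
  g : Maybe Bool → Maybe Bool → ℤ
  g a b = ∑ᴬ n (λ S → f (a ∷ (S ∷ʳ b)))
  transpose : ∀ a b c d e h i j k → (a + (b + c)) + ((d + (e + h)) + (i + (j + k))) ≡ (a + (d + i)) + ((b + (e + j)) + (c + (h + k)))
  transpose = solve-∀

𝟙 : Bool → ℕ
𝟙 true  = 1
𝟙 false = 0

countList : ∀ {A : Set} → (A → Bool) → List A → ℕ
countList p xs = length (filter (λ x → Bool._≟_ (p x) true) xs)

countList-map : ∀ {A B : Set} (p : B → Bool) (g : A → B) xs → countList p (List.map g xs) ≡ countList (λ x → p (g x)) xs
countList-map p g []       = refl
countList-map p g (x ∷ xs) with p (g x)
... | true  = cong N.suc (countList-map p g xs)
... | false = countList-map p g xs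

countList-tabulate-suc : ∀ n (h : Fin (N.suc n) → Bool) →
  countList h (Vec.toList (tabulate {n = n} Fin.suc)) ≡ count n (λ i → h (Fin.suc i))
countList-tabulate-suc n h = begin
  countList h (Vec.toList (tabulate Fin.suc))            ≡⟨ cong (λ V → countList h (Vec.toList V)) (VP.tabulate-allFin Fin.suc) ⟩
  countList h (Vec.toList (Vec.map Fin.suc (allFin n)))  ≡⟨ cong (countList h) (VP.toList-map Fin.suc (allFin n)) ⟩
  countList h (List.map Fin.suc (Vec.toList (allFin n))) ≡⟨ countList-map h Fin.suc (Vec.toList (allFin n)) ⟩
  count n (λ i → h (Fin.suc i))                          ∎

count-suc : ∀ n (h : Fin (N.suc n) → Bool) → count (N.suc n) h ≡ 𝟙 (h Fin.zero) N.+ count n (λ i → h (Fin.suc i))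
count-suc n h with h Fin.zero
... | true  = cong N.suc (countList-tabulate-suc n h)
... | false = countList-tabulate-suc n h

count-cong : ∀ n {h g : Fin n → Bool} → (∀ i → h i ≡ g i) → count n h ≡ count n g
count-cong N.zero    e = refl
count-cong (N.suc n) {h} {g} e = begin
  count (N.suc n) h                            ≡⟨ count-suc n h ⟩
  𝟙 (h Fin.zero) N.+ count n (λ i → h (Fin.suc i)) ≡⟨ cong₂ N._+_ (cong 𝟙 (e Fin.zero)) (count-cong n (λ i → e (Fin.suc i))) ⟩
  𝟙 (g Fin.zero) N.+ count n (λ i → g (Fin.suc i)) ≡⟨ count-suc n g ⟨
  count (N.suc n) g                            ∎

count-∷ʳ : ∀ n (h : Fin (N.suc n) → Bool) → count (N.suc n) h ≡ count n (λ i → h (inject₁ i)) N.+ 𝟙 (h (fromℕ n))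
count-∷ʳ N.zero    h = trans (count-suc 0 h) (NP.+-comm (𝟙 (h Fin.zero)) 0)
count-∷ʳ (N.suc n) h = begin
  count (N.suc (N.suc n)) h
    ≡⟨ count-suc (N.suc n) h ⟩
  𝟙 (h Fin.zero) N.+ count (N.suc n) (λ i → h (Fin.suc i))
    ≡⟨ cong (𝟙 (h Fin.zero) N.+_) (count-∷ʳ n (λ i → h (Fin.suc i))) ⟩
  𝟙 (h Fin.zero) N.+ (count n (λ i → h (Fin.suc (inject₁ i))) N.+ 𝟙 (h (fromℕ (N.suc n))))
    ≡⟨ NP.+-assoc (𝟙 (h Fin.zero)) _ _ ⟨
  𝟙 (h Fin.zero) N.+ count n (λ i → h (Fin.suc (inject₁ i))) N.+ 𝟙 (h (fromℕ (N.suc n)))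
    ≡⟨ cong (N._+ 𝟙 (h (fromℕ (N.suc n)))) (count-suc n (λ i → h (inject₁ i))) ⟨
  count (N.suc n) (λ i → h (inject₁ i)) N.+ 𝟙 (h (fromℕ (N.suc n)))
    ∎

data LastView {n : ℕ} : Fin (N.suc n) → Set where
  inner : (i : Fin n) → LastView (inject₁ i)
  last  : LastView (fromℕ n)

lastView : ∀ {n} (k : Fin (N.suc n)) → LastView k
lastView {N.zero}  Fin.zero    = last
lastView {N.suc n} Fin.zero    = inner Fin.zero
lastView {N.suc n} (Fin.suc k) with lastView k
... | inner i = inner (Fin.suc i)
... | last    = last

module _ {A : Set} where

  lookup-∷ʳ-inject₁ : ∀ {n} (V : Vec A n) c i → lookup (V ∷ʳ c) (inject₁ i) ≡ lookup V i
  lookup-∷ʳ-inject₁ (x ∷ V) c Fin.zero    = refl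
  lookup-∷ʳ-inject₁ (x ∷ V) c (Fin.suc i) = lookup-∷ʳ-inject₁ V c i

  lookup-∷ʳ-last : ∀ {n} (V : Vec A n) c → lookup (V ∷ʳ c) (fromℕ n) ≡ c
  lookup-∷ʳ-last []      c = refl
  lookup-∷ʳ-last (x ∷ V) c = lookup-∷ʳ-last V c

  updateAt-∷ʳ-inject₁ : ∀ {n} (V : Vec A n) c i (f : A → A) → updateAt (V ∷ʳ c) (inject₁ i) f ≡ updateAt V i f ∷ʳ c
  updateAt-∷ʳ-inject₁ (x ∷ V) c Fin.zero    f = refl
  updateAt-∷ʳ-inject₁ (x ∷ V) c (Fin.suc i) f = cong (x ∷_) (updateAt-∷ʳ-inject₁ V c i f)

  updateAt-∷ʳ-last : ∀ {n} (V : Vec A n) c (f : A → A) → updateAt (V ∷ʳ c) (fromℕ n) f ≡ V ∷ʳ f c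
  updateAt-∷ʳ-last []      c f = refl
  updateAt-∷ʳ-last (x ∷ V) c f = cong (x ∷_) (updateAt-∷ʳ-last V c f)

flipAt : ∀ {n} → Full n → Fin n → Full n
flipAt B i = updateAt B i not

flipAt-∷ʳ-inject₁ : ∀ {n} (B : Full n) c i → flipAt (B ∷ʳ c) (inject₁ i) ≡ flipAt B i ∷ʳ c
flipAt-∷ʳ-inject₁ B c i = updateAt-∷ʳ-inject₁ B c i not

flipAt-∷ʳ-last : ∀ {n} (B : Full n) c → flipAt (B ∷ʳ c) (fromℕ n) ≡ B ∷ʳ not c
flipAt-∷ʳ-last B c = updateAt-∷ʳ-last B c not

swap-∷ʳ-inject₁ : ∀ {n} (I : AdS n) x i → swap (I ∷ʳ x) (inject₁ i) ≡ swap I i ∷ʳ x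
swap-∷ʳ-inject₁ I x i = updateAt-∷ʳ-inject₁ I x i (Maybe.map not)

swap-∷ʳ-last : ∀ {n} (I : AdS n) x → swap (I ∷ʳ x) (fromℕ n) ≡ I ∷ʳ Maybe.map not x
swap-∷ʳ-last I x = updateAt-∷ʳ-last I x (Maybe.map not)

inSupport-lookup : ∀ {n} (I : AdS n) i → inSupport I i ≡ Maybe.is-just (lookup I i)
inSupport-lookup I i with lookup I i
... | nothing = refl
... | just _  = refl

inSupport-∷ʳ-inject₁ : ∀ {n} (I : AdS n) x i → inSupport (I ∷ʳ x) (inject₁ i) ≡ inSupport I i
inSupport-∷ʳ-inject₁ I x i = begin
  inSupport (I ∷ʳ x) (inject₁ i)        ≡⟨ inSupport-lookup (I ∷ʳ x) (inject₁ i) ⟩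
  Maybe.is-just (lookup (I ∷ʳ x) (inject₁ i))  ≡⟨ cong Maybe.is-just (lookup-∷ʳ-inject₁ I x i) ⟩
  Maybe.is-just (lookup I i)                   ≡⟨ inSupport-lookup I i ⟨
  inSupport I i                         ∎

inSupport-∷ʳ-last : ∀ {n} (I : AdS n) x → inSupport (I ∷ʳ x) (fromℕ n) ≡ Maybe.is-just x
inSupport-∷ʳ-last I x = trans (inSupport-lookup (I ∷ʳ x) _) (cong Maybe.is-just (lookup-∷ʳ-last I x))

card-∷ʳ-nothing : ∀ {n} (S : AdS n) → card (S ∷ʳ nothing) ≡ card S
card-∷ʳ-nothing []           = refl
card-∷ʳ-nothing (nothing ∷ S) = card-∷ʳ-nothing S
card-∷ʳ-nothing (just _ ∷ S)  = cong N.suc (card-∷ʳ-nothing S)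

card-∷ʳ-just : ∀ {n} (S : AdS n) b → card (S ∷ʳ just b) ≡ N.suc (card S)
card-∷ʳ-just []           b = refl
card-∷ʳ-just (nothing ∷ S) b = card-∷ʳ-just S b
card-∷ʳ-just (just _ ∷ S)  b = cong N.suc (card-∷ʳ-just S b)

card≤n : ∀ {n} (S : AdS n) → card S N.≤ n
card≤n []           = N.z≤n
card≤n (nothing ∷ S) = NP.m≤n⇒m≤1+n (card≤n S)
card≤n (just _ ∷ S)  = N.s≤s (card≤n S)

restrictTo-∷ʳ : ∀ {n} (I : AdS n) B x c → restrictTo (I ∷ʳ x) (B ∷ʳ c) ≡ restrictTo I B ∷ʳ Maybe.map (λ _ → c) x
restrictTo-∷ʳ []            []      nothing  c = refl
restrictTo-∷ʳ []            []      (just _) c = refl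
restrictTo-∷ʳ (nothing ∷ I) (b ∷ B) x c = cong (nothing ∷_) (restrictTo-∷ʳ I B x c)
restrictTo-∷ʳ (just _ ∷ I)  (b ∷ B) x c = cong (just b ∷_) (restrictTo-∷ʳ I B x c)

restrictTo-flipAt : ∀ {n} (I : AdS n) B y → restrictTo I (flipAt B y) ≡ swap (restrictTo I B) y
restrictTo-flipAt (nothing ∷ I) (b ∷ B) Fin.zero    = refl
restrictTo-flipAt (just _ ∷ I)  (b ∷ B) Fin.zero    = refl
restrictTo-flipAt (nothing ∷ I) (b ∷ B) (Fin.suc y) = cong (nothing ∷_) (restrictTo-flipAt I B y)
restrictTo-flipAt (just _ ∷ I)  (b ∷ B) (Fin.suc y) = cong (just b ∷_) (restrictTo-flipAt I B y)

restrictTo-flipAt-outside : ∀ {n} (I : AdS n) B y → lookup I y ≡ nothing → restrictTo I (flipAt B y) ≡ restrictTo I B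
restrictTo-flipAt-outside (nothing ∷ I) (b ∷ B) Fin.zero    _ = refl
restrictTo-flipAt-outside (nothing ∷ I) (b ∷ B) (Fin.suc y) e = cong (nothing ∷_) (restrictTo-flipAt-outside I B y e)
restrictTo-flipAt-outside (just _ ∷ I)  (b ∷ B) (Fin.suc y) e = cong (just b ∷_) (restrictTo-flipAt-outside I B y e)

agrees : Maybe Bool → Bool → Bool
agrees nothing  b = true
agrees (just s) b = does (Bool._≟_ s b)

agrees-just⁻ : ∀ {b c} → agrees (just b) c ≡ true → c ≡ b
agrees-just⁻ {false} {false} _ = refl
agrees-just⁻ {true}  {true}  _ = refl

agrees-just-refl : ∀ b → agrees (just b) b ≡ true
agrees-just-refl false = refl
agrees-just-refl true  = refl

subsetB-∷ʳ : ∀ {n} (I : AdS n) B x c → subsetB (I ∷ʳ x) (B ∷ʳ c) ≡ subsetB I B ∧ agrees x c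
subsetB-∷ʳ []            []      nothing  c = refl
subsetB-∷ʳ []            []      (just s) c = BP.∧-identityʳ _
subsetB-∷ʳ (nothing ∷ I) (b ∷ B) x c = subsetB-∷ʳ I B x c
subsetB-∷ʳ (just s ∷ I)  (b ∷ B) x c =
  trans (cong (does (Bool._≟_ s b) ∧_) (subsetB-∷ʳ I B x c)) (sym (BP.∧-assoc (does (Bool._≟_ s b)) _ _))

subsetB⇒restrictTo≡ : ∀ {n} (I : AdS n) B → subsetB I B ≡ true → restrictTo I B ≡ I
subsetB⇒restrictTo≡ []            []      _ = refl
subsetB⇒restrictTo≡ (nothing ∷ I) (b ∷ B) e = cong (nothing ∷_) (subsetB⇒restrictTo≡ I B e)
subsetB⇒restrictTo≡ (just s ∷ I)  (b ∷ B) e with ∧-true⁻ {does (Bool._≟_ s b)} e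
... | s≟b , rest = cong₂ _∷_ (cong just (agrees-just⁻ s≟b)) (subsetB⇒restrictTo≡ I B rest)

eqAdS⇒≡ : ∀ {n} (X Y : AdS n) → eqAdS X Y ≡ true → X ≡ Y
eqAdS⇒≡ []      []      _ = refl
eqAdS⇒≡ (x ∷ X) (y ∷ Y) e with ∧-true⁻ {eqMB x y} e
... | exy , rest = cong₂ _∷_ (eqMB⇒≡ x y exy) (eqAdS⇒≡ X Y rest)
  where
  eqMB⇒≡ : ∀ x y → eqMB x y ≡ true → x ≡ y
  eqMB⇒≡ nothing      nothing      _ = refl
  eqMB⇒≡ (just false) (just false) _ = refl
  eqMB⇒≡ (just true)  (just true)  _ = refl

≡⇒eqAdS : ∀ {n} {X Y : AdS n} → X ≡ Y → eqAdS X Y ≡ true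
≡⇒eqAdS {X = []}    refl = refl
≡⇒eqAdS {X = x ∷ X} refl = ∧-true⁺ (eqMB-refl x) (≡⇒eqAdS {X = X} refl)
  where
  eqMB-refl : ∀ x → eqMB x x ≡ true
  eqMB-refl nothing      = refl
  eqMB-refl (just false) = refl
  eqMB-refl (just true)  = refl

-- The rank function as a distance

mismatch : Bool → Bool → ℕ
mismatch s b = if does (Bool._≟_ s b) then 0 else 1

mismatch-refl : ∀ b → mismatch b b ≡ 0
mismatch-refl false = refl
mismatch-refl true  = refl

mismatch-≢ : ∀ {s b} → s ≢ b → mismatch s b ≡ 1
mismatch-≢ {s} {b} q = cong (λ d → if d then 0 else 1) (Dec.dec-false (Bool._≟_ s b) q)

mismatch≤1 : ∀ s b → mismatch s b N.≤ 1
mismatch≤1 s b with does (Bool._≟_ s b)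
... | true  = N.z≤n
... | false = NP.≤-refl

distance : ∀ {n} → AdS n → Full n → ℕ
distance []            []      = 0
distance (nothing ∷ S) (b ∷ B) = distance S B
distance (just s ∷ S)  (b ∷ B) = mismatch s b N.+ distance S B

distance-∷ʳ : ∀ {n} (S : AdS n) B x c → distance (S ∷ʳ x) (B ∷ʳ c) ≡ distance S B N.+ distance (x ∷ []) (c ∷ [])
distance-∷ʳ []            []      nothing  c = refl
distance-∷ʳ []            []      (just s) c = refl
distance-∷ʳ (nothing ∷ S) (b ∷ B) x c = distance-∷ʳ S B x c
distance-∷ʳ (just s ∷ S)  (b ∷ B) x c =
  trans (cong (mismatch s b N.+_) (distance-∷ʳ S B x c)) (sym (NP.+-assoc (mismatch s b) _ _))

distance-∷ʳ-nothing : ∀ {n} (S : AdS n) B c → distance (S ∷ʳ nothing) (B ∷ʳ c) ≡ distance S B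
distance-∷ʳ-nothing S B c = trans (distance-∷ʳ S B nothing c) (NP.+-identityʳ _)

distance-∷ʳ-just : ∀ {n} (S : AdS n) B s c → distance (S ∷ʳ just s) (B ∷ʳ c) ≡ distance S B N.+ mismatch s c
distance-∷ʳ-just S B s c = trans (distance-∷ʳ S B (just s) c) (cong (distance S B N.+_) (NP.+-identityʳ _))

distance≤card : ∀ {n} (S : AdS n) B → distance S B N.≤ card S
distance≤card []            []      = N.z≤n
distance≤card (nothing ∷ S) (b ∷ B) = distance≤card S B
distance≤card (just s ∷ S)  (b ∷ B) = NP.+-mono-≤ (mismatch≤1 s b) (distance≤card S B)

distance-flipAt : ∀ {n} (S : AdS n) B y → distance S (flipAt B y) N.≤ N.suc (distance S B)
distance-flipAt (nothing ∷ S) (b ∷ B) Fin.zero    = NP.n≤1+n _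
distance-flipAt (just s ∷ S)  (b ∷ B) Fin.zero    = NP.+-monoˡ-≤ _ (step s b)
  where
  step : ∀ s b → mismatch s (not b) N.≤ N.suc (mismatch s b)
  step false false = N.s≤s N.z≤n
  step false true  = N.z≤n
  step true  false = N.z≤n
  step true  true  = N.s≤s N.z≤n
distance-flipAt (nothing ∷ S) (b ∷ B) (Fin.suc y) = distance-flipAt S B y
distance-flipAt (just s ∷ S)  (b ∷ B) (Fin.suc y) =
  subst (mismatch s b N.+ distance S (flipAt B y) N.≤_) (NP.+-suc (mismatch s b) (distance S B))
        (NP.+-monoʳ-≤ (mismatch s b) (distance-flipAt S B y))

signedMeet≡card-2distance : ∀ {n} (S : AdS n) B → signedMeet S B ≡ + card S - (+ distance S B + + distance S B)
signedMeet≡card-2distance []            []      = refl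
signedMeet≡card-2distance (nothing ∷ S) (b ∷ B) = signedMeet≡card-2distance S B
signedMeet≡card-2distance (just s ∷ S)  (b ∷ B) with does (Bool._≟_ s b)
... | true  = trans (cong (λ z → + 1 + z) (signedMeet≡card-2distance S B)) (agree (+ card S) (+ distance S B))
  where
  agree : ∀ c d → + 1 + (c - (d + d)) ≡ (+ 1 + c) - (d + d)
  agree = solve-∀
... | false = trans (cong (λ z → - + 1 + z) (signedMeet≡card-2distance S B)) (disagree (+ card S) (+ distance S B))
  where
  disagree : ∀ c d → - + 1 + (c - (d + d)) ≡ (+ 1 + c) - ((+ 1 + d) + (+ 1 + d))
  disagree = solve-∀

MinDistance : ∀ {n} → Family n → AdS n → ℕ → Set
MinDistance F S k = (∃[ B ] (F B ≡ true × distance S B ≡ k)) × (∀ B → F B ≡ true → k N.≤ distance S B)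

minDistance-unique : ∀ {n} (F : Family n) S {k k′} → MinDistance F S k → MinDistance F S k′ → k ≡ k′
minDistance-unique F S ((B , fB , refl) , lb) ((B′ , fB′ , refl) , lb′) = NP.≤-antisym (lb B′ fB′) (lb′ B fB)

module _ {A : Set} (f : A → ℤ) (base : ℤ) where

  maxFrom : List A → ℤ
  maxFrom = List.foldr (λ x m → f x ⊔ m) base

  maxFrom-upper : ∀ {x} xs → x ∈ xs → f x Z.≤ maxFrom xs
  maxFrom-upper (y ∷ xs) (here refl) = ZP.i≤i⊔j (f y) (maxFrom xs)
  maxFrom-upper (y ∷ xs) (there x∈)  = ZP.≤-trans (maxFrom-upper xs x∈) (ZP.i≤j⊔i (f y) (maxFrom xs))

  maxFrom-attained : ∀ xs → maxFrom xs ≡ base ⊎ ∃[ x ] (x ∈ xs × maxFrom xs ≡ f x)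
  maxFrom-attained []       = inj₁ refl
  maxFrom-attained (y ∷ xs) with ZP.⊔-sel (f y) (maxFrom xs)
  ... | inj₁ e = inj₂ (y , here refl , e)
  ... | inj₂ e with maxFrom-attained xs
  ...   | inj₁ e′ = inj₁ (trans e e′)
  ...   | inj₂ (x , x∈ , e′) = inj₂ (x , there x∈ , trans e e′)

private
  halve-twice : ∀ c d → Z.∣ + c - (+ c - (+ d + + d)) ∣ N./ 2 ≡ d
  halve-twice c d = begin
    Z.∣ + c - (+ c - (+ d + + d)) ∣ N./ 2 ≡⟨ cong (λ z → Z.∣ z ∣ N./ 2) (cancel (+ c) (+ d)) ⟩
    (d N.+ d) N./ 2                       ≡⟨ cong (N._/ 2) (trans (cong (d N.+_) (sym (NP.+-identityʳ d))) (NP.*-comm 2 d)) ⟩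
    d N.* 2 N./ 2                         ≡⟨ DM.m*n/n≡m d 2 ⟩
    d                                     ∎
    where
    cancel : ∀ c d → c - (c - (d + d)) ≡ d + d
    cancel = solve-∀

  twice-antitone : ∀ c a b → + c - (+ a + + a) Z.≤ + c - (+ b + + b) → b N.≤ a
  twice-antitone c a b h = NP.≮⇒≥ λ a<b →
    ZP.<⇒≱ (ZP.+-monoʳ-< (+ c) (ZP.neg-mono-< (Z.+<+ (NP.+-mono-< a<b a<b)))) h

  twice-lower : ∀ c d → d N.≤ c → - (+ c) Z.≤ + c - (+ d + + d)
  twice-lower c d d≤c = subst (Z._≤ + c - (+ d + + d)) (self (+ c))
    (ZP.+-monoʳ-≤ (+ c) (ZP.neg-mono-≤ (Z.+≤+ (NP.+-mono-≤ d≤c d≤c))))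
    where
    self : ∀ c → c - (c + c) ≡ - c
    self = solve-∀

-- g_D(S) = |S| - 2 min_B |S \ B|, so the exponent (|S| - g_D(S))/2 is that minimum.
uExp-minDistance : ∀ {n} (F : Family n) S → Nonempty F → MinDistance F S (uExpF F S)
uExp-minDistance {n} F S (B₀ , fB₀) = (Bₘ , fBₘ , sym uExp≡) , lower
  where
  feasibles : List (Full n)
  feasibles = filter (λ B → Bool._≟_ (F B) true) (allFull n)
  ∈-feasibles : ∀ {B} → F B ≡ true → B ∈ feasibles
  ∈-feasibles {B} fB = ∈-filter⁺ (λ B → Bool._≟_ (F B) true) (∈-allFull B) fB
  dist-form : ∀ B → signedMeet S B ≡ + card S - (+ distance S B + + distance S B)
  dist-form = signedMeet≡card-2distance S
  rank-attained : ∃[ B ] (F B ≡ true × rankF F S ≡ signedMeet S B)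
  rank-attained with maxFrom-attained (signedMeet S) (- (+ card S)) feasibles
  ... | inj₂ (B , B∈ , e) = B , proj₂ (∈-filter⁻ (λ B → Bool._≟_ (F B) true) {xs = allFull n} B∈) , e
  ... | inj₁ e = B₀ , fB₀ , ZP.≤-antisym
        (ZP.≤-trans (ZP.≤-reflexive e) (subst (- (+ card S) Z.≤_) (sym (dist-form B₀)) (twice-lower (card S) _ (distance≤card S B₀))))
        (maxFrom-upper (signedMeet S) (- (+ card S)) feasibles (∈-feasibles fB₀))
  Bₘ : Full n
  Bₘ = proj₁ rank-attained
  fBₘ : F Bₘ ≡ true
  fBₘ = proj₁ (proj₂ rank-attained)
  rank≡ : rankF F S ≡ + card S - (+ distance S Bₘ + + distance S Bₘ)
  rank≡ = trans (proj₂ (proj₂ rank-attained)) (dist-form Bₘ)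
  uExp≡ : uExpF F S ≡ distance S Bₘ
  uExp≡ = trans (cong (λ r → Z.∣ + card S - r ∣ N./ 2) rank≡) (halve-twice (card S) (distance S Bₘ))
  lower : ∀ B → F B ≡ true → uExpF F S N.≤ distance S B
  lower B fB = subst (N._≤ distance S B) (sym uExp≡) (twice-antitone (card S) (distance S B) (distance S Bₘ)
    (subst₂ Z._≤_ (dist-form B) rank≡ (maxFrom-upper (signedMeet S) (- (+ card S)) feasibles (∈-feasibles fB))))

-- Fibres, projection and the symmetric exchange property

fibre : ∀ {n} → Family (N.suc n) → Bool → Family n
fibre F b B = F (B ∷ʳ b)

-- the feasible sets of the projection D({n})
project : ∀ {n} → Family (N.suc n) → Family n
project F B = F (B ∷ʳ false) ∨ F (B ∷ʳ true)

IsFibre : ∀ {n} → Family n → Family (N.suc n) → Bool → Set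
IsFibre G F b = ∀ B → G B ≡ F (B ∷ʳ b)

project⁺ : ∀ {n} (F : Family (N.suc n)) {B} c → F (B ∷ʳ c) ≡ true → project F B ≡ true
project⁺ F false e = ∨-trueˡ _ e
project⁺ F true  e = ∨-trueʳ (F (_ ∷ʳ false)) e

project⁻ : ∀ {n} (F : Family (N.suc n)) {B} → project F B ≡ true → ∃[ c ] F (B ∷ʳ c) ≡ true
project⁻ F e with ∨-true⁻ e
... | inj₁ f = false , f
... | inj₂ t = true , t

project-nonempty : ∀ {n} (F : Family (N.suc n)) b → Nonempty (fibre F b) → Nonempty (project F)
project-nonempty F b (B , fB) = B , project⁺ F b fB

project-isFibre : ∀ {n} (F : Family (N.suc n)) b → Empty (fibre F (not b)) → IsFibre (project F) F b
project-isFibre F false emp B with F (B ∷ʳ true) in e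
... | false = BP.∨-identityʳ _
... | true  = ⊥-elim (emp B e)
project-isFibre F true  emp B with F (B ∷ʳ false) in e
... | false = refl
... | true  = ⊥-elim (emp B e)

SymmetricExchange : ∀ {n} → Family n → Set
SymmetricExchange F = ∀ A B → F A ≡ true → F B ≡ true → ∀ x → lookup A x ≢ lookup B x →
  F (flipAt A x) ≡ true ⊎ ∃[ y ] (y ≢ x × lookup A y ≢ lookup B y × F (flipAt (flipAt A x) y) ≡ true)

module _ {n} (F : Family (N.suc n)) (exchange : SymmetricExchange F) where

  private
    differ-∷ʳ : ∀ (A B : Full n) {a b} x → lookup A x ≢ lookup B x → lookup (A ∷ʳ a) (inject₁ x) ≢ lookup (B ∷ʳ b) (inject₁ x)
    differ-∷ʳ A B {a} {b} x d e = d (trans (sym (lookup-∷ʳ-inject₁ A a x)) (trans e (lookup-∷ʳ-inject₁ B b x)))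

    differ-∷ʳ⁻ : ∀ (A B : Full n) {a b} y → lookup (A ∷ʳ a) (inject₁ y) ≢ lookup (B ∷ʳ b) (inject₁ y) → lookup A y ≢ lookup B y
    differ-∷ʳ⁻ A B {a} {b} y d e = d (trans (lookup-∷ʳ-inject₁ A a y) (trans e (sym (lookup-∷ʳ-inject₁ B b y))))

    flipAt²-∷ʳ : ∀ (A : Full n) c x y → flipAt (flipAt (A ∷ʳ c) (inject₁ x)) (inject₁ y) ≡ flipAt (flipAt A x) y ∷ʳ c
    flipAt²-∷ʳ A c x y = trans (cong (λ V → flipAt V (inject₁ y)) (flipAt-∷ʳ-inject₁ A c x)) (flipAt-∷ʳ-inject₁ (flipAt A x) c y)

    feasible-≡ : ∀ {V W} → V ≡ W → F V ≡ true → F W ≡ true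
    feasible-≡ refl f = f

  symmetricExchange-fibre : ∀ b → SymmetricExchange (fibre F b)
  symmetricExchange-fibre b A B fA fB x d with exchange (A ∷ʳ b) (B ∷ʳ b) fA fB (inject₁ x) (differ-∷ʳ A B x d)
  ... | inj₁ f = inj₁ (feasible-≡ (flipAt-∷ʳ-inject₁ A b x) f)
  ... | inj₂ (y , y≢x , dy , f) with lastView y
  ...   | last    = ⊥-elim (dy (trans (lookup-∷ʳ-last A b) (sym (lookup-∷ʳ-last B b))))
  ...   | inner y′ = inj₂ (y′ , (λ e → y≢x (cong inject₁ e)) , differ-∷ʳ⁻ A B y′ dy , feasible-≡ (flipAt²-∷ʳ A b x y′) f)

  -- A partner flip at the last coordinate is invisible in the projection, leaving a single flip there.
  symmetricExchange-project : SymmetricExchange (project F)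
  symmetricExchange-project A B pA pB x d with project⁻ F pA | project⁻ F pB
  ... | a , fA | b , fB with exchange (A ∷ʳ a) (B ∷ʳ b) fA fB (inject₁ x) (differ-∷ʳ A B x d)
  ...   | inj₁ f = inj₁ (project⁺ F a (feasible-≡ (flipAt-∷ʳ-inject₁ A a x) f))
  ...   | inj₂ (y , y≢x , dy , f) with lastView y
  ...     | last = inj₁ (project⁺ F (not a) (feasible-≡
              (trans (cong (λ V → flipAt V (fromℕ n)) (flipAt-∷ʳ-inject₁ A a x)) (flipAt-∷ʳ-last (flipAt A x) a)) f))
  ...     | inner y′ = inj₂ (y′ , (λ e → y≢x (cong inject₁ e)) , differ-∷ʳ⁻ A B y′ dy ,
              project⁺ F a (feasible-≡ (flipAt²-∷ʳ A a x y′) f))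

  exchange-last : ∀ A B b → F (A ∷ʳ b) ≡ true → F (B ∷ʳ not b) ≡ true →
    F (A ∷ʳ not b) ≡ true ⊎ ∃[ y ] F (flipAt A y ∷ʳ not b) ≡ true
  exchange-last A B b fA fB with exchange (A ∷ʳ b) (B ∷ʳ not b) fA fB (fromℕ n)
    (λ e → BP.not-¬ {b} refl (trans (sym (lookup-∷ʳ-last A b)) (trans e (lookup-∷ʳ-last B (not b)))))
  ... | inj₁ f = inj₁ (feasible-≡ (flipAt-∷ʳ-last A b) f)
  ... | inj₂ (y , y≢last , _ , f) with lastView y
  ...   | last     = ⊥-elim (y≢last refl)
  ...   | inner y′ = inj₂ (y′ , feasible-≡
            (trans (cong (λ V → flipAt V (inject₁ y′)) (flipAt-∷ʳ-last A b)) (flipAt-∷ʳ-inject₁ A (not b) y′)) f)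

uExp-∷ʳ-nothing : ∀ {n} (F : Family (N.suc n)) S → Nonempty F → uExpF F (S ∷ʳ nothing) ≡ uExpF (project F) S
uExp-∷ʳ-nothing F S (B₀ , fB₀) with Vec.initLast B₀
... | B₀′ , c₀ , refl with uExp-minDistance (project F) S (B₀′ , project⁺ F c₀ fB₀)
...   | (B , pB , dB) , lower = minDistance-unique F (S ∷ʳ nothing) (uExp-minDistance F (S ∷ʳ nothing) (_ , fB₀)) extended
  where
  extended : MinDistance F (S ∷ʳ nothing) (uExpF (project F) S)
  extended with project⁻ F pB
  ... | c , fB = (B ∷ʳ c , fB , trans (distance-∷ʳ-nothing S B c) dB) , lower′
    where
    lower′ : ∀ B → F B ≡ true → uExpF (project F) S N.≤ distance (S ∷ʳ nothing) B
    lower′ B fB with Vec.initLast B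
    ... | B′ , c′ , refl = subst (uExpF (project F) S N.≤_) (sym (distance-∷ʳ-nothing S B′ c′)) (lower B′ (project⁺ F c′ fB))

module _ {n} (F : Family (N.suc n)) (G : Family n) b (isFibre : IsFibre G F b) (S : AdS n) (nonempty : Nonempty G) where

  private
    minG : MinDistance G S (uExpF G S)
    minG = uExp-minDistance G S nonempty
    B₀ : Full n
    B₀ = proj₁ (proj₁ minG)
    gB₀ : G B₀ ≡ true
    gB₀ = proj₁ (proj₂ (proj₁ minG))
    dB₀ : distance S B₀ ≡ uExpF G S
    dB₀ = proj₂ (proj₂ (proj₁ minG))
    lowerG : ∀ B → G B ≡ true → uExpF G S N.≤ distance S B
    lowerG = proj₂ minG
    fB₀ : F (B₀ ∷ʳ b) ≡ true
    fB₀ = trans (sym (isFibre B₀)) gB₀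

  -- Sets in the opposite fibre cost one extra mismatch, so they are harmless as long as each has
  -- a G-set at most one step further from S.
  uExp-∷ʳ-just : (∀ B → F (B ∷ʳ not b) ≡ true → ∃[ B″ ] (G B″ ≡ true × distance S B″ N.≤ N.suc (distance S B))) →
    uExpF F (S ∷ʳ just b) ≡ uExpF G S
  uExp-∷ʳ-just nearby = minDistance-unique F (S ∷ʳ just b) (uExp-minDistance F (S ∷ʳ just b) (_ , fB₀)) extended
    where
    same-side : ∀ B → distance (S ∷ʳ just b) (B ∷ʳ b) ≡ distance S B
    same-side B = trans (distance-∷ʳ-just S B b b) (trans (cong (distance S B N.+_) (mismatch-refl b)) (NP.+-identityʳ _))
    extended : MinDistance F (S ∷ʳ just b) (uExpF G S)
    extended = (B₀ ∷ʳ b , fB₀ , trans (same-side B₀) dB₀) , lower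
      where
      lower : ∀ B → F B ≡ true → uExpF G S N.≤ distance (S ∷ʳ just b) B
      lower B fB with Vec.initLast B
      ... | B′ , c , refl with Bool._≟_ c b
      ...   | yes refl = subst (uExpF G S N.≤_) (sym (same-side B′)) (lowerG B′ (trans (isFibre B′) fB))
      ...   | no c≢b with nearby B′ (subst (λ z → F (B′ ∷ʳ z) ≡ true) (BP.¬-not c≢b) fB)
      ...     | B″ , gB″ , near = subst (uExpF G S N.≤_) (sym other-side) (NP.≤-trans (lowerG B″ gB″) near)
        where
        other-side : distance (S ∷ʳ just b) (B′ ∷ʳ c) ≡ N.suc (distance S B′)
        other-side = trans (distance-∷ʳ-just S B′ b c) (trans (cong (distance S B′ N.+_) (mismatch-≢ (λ e → c≢b (sym e)))) (NP.+-comm _ 1))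

  uExp-∷ʳ-just-forbidden : Empty (fibre F (not b)) → uExpF F (S ∷ʳ just (not b)) ≡ N.suc (uExpF G S)
  uExp-∷ʳ-just-forbidden emp = minDistance-unique F (S ∷ʳ just (not b)) (uExp-minDistance F (S ∷ʳ just (not b)) (_ , fB₀)) extended
    where
    wrong-side : ∀ B → distance (S ∷ʳ just (not b)) (B ∷ʳ b) ≡ N.suc (distance S B)
    wrong-side B = trans (distance-∷ʳ-just S B (not b) b) (trans (cong (distance S B N.+_) (mismatch-≢ (λ e → BP.not-¬ {b} refl (sym e)))) (NP.+-comm _ 1))
    extended : MinDistance F (S ∷ʳ just (not b)) (N.suc (uExpF G S))
    extended = (B₀ ∷ʳ b , fB₀ , trans (wrong-side B₀) (cong N.suc dB₀)) , lower
      where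
      lower : ∀ B → F B ≡ true → N.suc (uExpF G S) N.≤ distance (S ∷ʳ just (not b)) B
      lower B fB with Vec.initLast B
      ... | B′ , c , refl with Bool._≟_ c b
      ...   | yes refl = subst (N.suc (uExpF G S) N.≤_) (sym (wrong-side B′)) (N.s≤s (lowerG B′ (trans (isFibre B′) fB)))
      ...   | no c≢b  = ⊥-elim (emp B′ (subst (λ z → F (B′ ∷ʳ z) ≡ true) (BP.¬-not c≢b) fB))

module _ {n} (F : Family n) where

  independent⁺ : ∀ I B → F B ≡ true → subsetB I B ≡ true → independentF F I ≡ true
  independent⁺ I B fB sub = any-true⁺ (λ B → F B ∧ subsetB I B) (∈-allFull B) (∧-true⁺ fB sub)

  independent⁻ : ∀ I → independentF F I ≡ true → ∃[ B ] (F B ≡ true × subsetB I B ≡ true)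
  independent⁻ I e with any-true⁻ (λ B → F B ∧ subsetB I B) (allFull n) e
  ... | B , h = B , ∧-true⁻ h

  feasibleInProj⁺ : ∀ I X B → F B ≡ true → restrictTo I B ≡ X → feasibleInProjF F I X ≡ true
  feasibleInProj⁺ I X B fB r = any-true⁺ (λ B → F B ∧ eqAdS (restrictTo I B) X) (∈-allFull B) (∧-true⁺ fB (≡⇒eqAdS r))

  feasibleInProj⁻ : ∀ I X → feasibleInProjF F I X ≡ true → ∃[ B ] (F B ≡ true × restrictTo I B ≡ X)
  feasibleInProj⁻ I X e with any-true⁻ (λ B → F B ∧ eqAdS (restrictTo I B) X) (allFull n) e
  ... | B , h with ∧-true⁻ {F B} h
  ...   | fB , r = B , fB , eqAdS⇒≡ _ _ r

module _ {n} (F : Family (N.suc n)) where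

  independent-∷ʳ⁻ : ∀ I x → independentF F (I ∷ʳ x) ≡ true →
    ∃[ B ] ∃[ c ] (F (B ∷ʳ c) ≡ true × subsetB I B ≡ true × agrees x c ≡ true)
  independent-∷ʳ⁻ I x e with independent⁻ F (I ∷ʳ x) e
  ... | B , fB , sub with Vec.initLast B
  ...   | B′ , c , refl = B′ , c , fB , ∧-true⁻ (trans (sym (subsetB-∷ʳ I B′ x c)) sub)

  independent-∷ʳ⁺ : ∀ I x B c → F (B ∷ʳ c) ≡ true → subsetB I B ≡ true → agrees x c ≡ true → independentF F (I ∷ʳ x) ≡ true
  independent-∷ʳ⁺ I x B c fB sub agree = independent⁺ F (I ∷ʳ x) (B ∷ʳ c) fB (trans (subsetB-∷ʳ I B x c) (∧-true⁺ sub agree))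

  feasibleInProj-∷ʳ⁻ : ∀ I X x y → feasibleInProjF F (I ∷ʳ x) (X ∷ʳ y) ≡ true →
    ∃[ B ] ∃[ c ] (F (B ∷ʳ c) ≡ true × restrictTo I B ≡ X × Maybe.map (λ _ → c) x ≡ y)
  feasibleInProj-∷ʳ⁻ I X x y e with feasibleInProj⁻ F (I ∷ʳ x) (X ∷ʳ y) e
  ... | B , fB , r with Vec.initLast B
  ...   | B′ , c , refl = B′ , c , fB , VP.∷ʳ-injective _ _ (trans (sym (restrictTo-∷ʳ I B′ x c)) r)

  feasibleInProj-∷ʳ⁺ : ∀ I X x B c → F (B ∷ʳ c) ≡ true → restrictTo I B ≡ X →
    feasibleInProjF F (I ∷ʳ x) (X ∷ʳ Maybe.map (λ _ → c) x) ≡ true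
  feasibleInProj-∷ʳ⁺ I X x B c fB r = feasibleInProj⁺ F (I ∷ʳ x) (X ∷ʳ _) (B ∷ʳ c) fB (trans (restrictTo-∷ʳ I B x c) (cong (_∷ʳ _) r))

  independent-∷ʳ-nothing : ∀ I → independentF F (I ∷ʳ nothing) ≡ independentF (project F) I
  independent-∷ʳ-nothing I = ≡-from-⇔ to from
    where
    to : independentF F (I ∷ʳ nothing) ≡ true → independentF (project F) I ≡ true
    to e with independent-∷ʳ⁻ I nothing e
    ... | B , c , fB , sub , _ = independent⁺ (project F) I B (project⁺ F c fB) sub
    from : independentF (project F) I ≡ true → independentF F (I ∷ʳ nothing) ≡ true
    from e with independent⁻ (project F) I e
    ... | B , pB , sub with project⁻ F pB
    ...   | c , fB = independent-∷ʳ⁺ I nothing B c fB sub refl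

  independent-∷ʳ-just : ∀ {G : Family n} {b} → IsFibre G F b → ∀ I → independentF F (I ∷ʳ just b) ≡ independentF G I
  independent-∷ʳ-just {G} {b} isFibre I = ≡-from-⇔ to from
    where
    to : independentF F (I ∷ʳ just b) ≡ true → independentF G I ≡ true
    to e with independent-∷ʳ⁻ I (just b) e
    ... | B , c , fB , sub , agree with agrees-just⁻ {b} {c} agree
    ...   | refl = independent⁺ G I B (trans (isFibre B) fB) sub
    from : independentF G I ≡ true → independentF F (I ∷ʳ just b) ≡ true
    from e with independent⁻ G I e
    ... | B , gB , sub = independent-∷ʳ⁺ I (just b) B b (trans (sym (isFibre B)) gB) sub (agrees-just-refl b)

  independent-∷ʳ-forbidden : ∀ {c} → Empty (fibre F c) → ∀ I → independentF F (I ∷ʳ just c) ≡ false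
  independent-∷ʳ-forbidden {c} emp I with independentF F (I ∷ʳ just c) in e
  ... | false = refl
  ... | true with independent-∷ʳ⁻ I (just c) e
  ...   | B , c′ , fB , _ , agree with agrees-just⁻ {c} {c′} agree
  ...     | refl = ⊥-elim (emp B fB)

  feasibleInProj-∷ʳ-nothing : ∀ I X → feasibleInProjF F (I ∷ʳ nothing) (X ∷ʳ nothing) ≡ feasibleInProjF (project F) I X
  feasibleInProj-∷ʳ-nothing I X = ≡-from-⇔ to from
    where
    to : feasibleInProjF F (I ∷ʳ nothing) (X ∷ʳ nothing) ≡ true → feasibleInProjF (project F) I X ≡ true
    to e with feasibleInProj-∷ʳ⁻ I X nothing nothing e
    ... | B , c , fB , r , _ = feasibleInProj⁺ (project F) I X B (project⁺ F c fB) r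
    from : feasibleInProjF (project F) I X ≡ true → feasibleInProjF F (I ∷ʳ nothing) (X ∷ʳ nothing) ≡ true
    from e with feasibleInProj⁻ (project F) I X e
    ... | B , pB , r with project⁻ F pB
    ...   | c , fB = feasibleInProj-∷ʳ⁺ I X nothing B c fB r

  feasibleInProj-∷ʳ-just : ∀ {G : Family n} {b} → IsFibre G F b → ∀ s I X →
    feasibleInProjF F (I ∷ʳ just s) (X ∷ʳ just b) ≡ feasibleInProjF G I X
  feasibleInProj-∷ʳ-just {G} {b} isFibre s I X = ≡-from-⇔ to from
    where
    to : feasibleInProjF F (I ∷ʳ just s) (X ∷ʳ just b) ≡ true → feasibleInProjF G I X ≡ true
    to e with feasibleInProj-∷ʳ⁻ I X (just s) (just b) e
    ... | B , c , fB , r , refl = feasibleInProj⁺ G I X B (trans (isFibre B) fB) r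
    from : feasibleInProjF G I X ≡ true → feasibleInProjF F (I ∷ʳ just s) (X ∷ʳ just b) ≡ true
    from e with feasibleInProj⁻ G I X e
    ... | B , gB , r = feasibleInProj-∷ʳ⁺ I X (just s) B b (trans (sym (isFibre B)) gB) r

  feasibleInProj-∷ʳ-forbidden : ∀ {c} → Empty (fibre F c) → ∀ s I X → feasibleInProjF F (I ∷ʳ just s) (X ∷ʳ just c) ≡ false
  feasibleInProj-∷ʳ-forbidden {c} emp s I X with feasibleInProjF F (I ∷ʳ just s) (X ∷ʳ just c) in e
  ... | false = refl
  ... | true with feasibleInProj-∷ʳ⁻ I X (just s) (just c) e
  ...   | B , c′ , fB , _ , refl = ⊥-elim (emp B fB)

any-allFin-∷ʳ : ∀ n (p : Fin (N.suc n) → Bool) (q : Fin n → Bool) → (∀ j → p (inject₁ j) ≡ q j) → p (fromℕ n) ≡ false →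
  any p (Vec.toList (allFin (N.suc n))) ≡ any q (Vec.toList (allFin n))
any-allFin-∷ʳ n p q p≡q p-last = ≡-from-⇔ to from
  where
  to : any p (Vec.toList (allFin (N.suc n))) ≡ true → any q (Vec.toList (allFin n)) ≡ true
  to e with any-true⁻ p (Vec.toList (allFin (N.suc n))) e
  ... | j , pj with lastView j
  ...   | inner j′ = any-true⁺ q (∈-allFin j′) (trans (sym (p≡q j′)) pj)
  ...   | last     = ⊥-elim (true≢false (trans (sym pj) p-last))
  from : any q (Vec.toList (allFin n)) ≡ true → any p (Vec.toList (allFin (N.suc n))) ≡ true
  from e with any-true⁻ q (Vec.toList (allFin n)) e
  ... | j , qj = any-true⁺ p (∈-allFin (inject₁ j)) (trans (p≡q j) qj)

module _ {n} (F : Family n) (I : AdS n) where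

  inactive-outside-support : ∀ i → inSupport I i ≡ false → activeF F I i ≡ false
  inactive-outside-support i e rewrite e = refl

  inactive-if-flippable : ∀ i → feasibleInProjF F I (swap I i) ≡ true → activeF F I i ≡ false
  inactive-if-flippable i e rewrite e = BP.∧-zeroʳ (inSupport I i)

  inactive-if-pair-flippable : ∀ i j → toℕ j N.< toℕ i → inSupport I j ≡ true →
    feasibleInProjF F I (swap (swap I i) j) ≡ true → activeF F I i ≡ false
  inactive-if-pair-flippable i j j<i j∈I e = begin
    inSupport I i ∧ (not (feasibleInProjF F I (swap I i)) ∧ not (any pair (Vec.toList (allFin n))))
      ≡⟨ cong (λ z → inSupport I i ∧ (not (feasibleInProjF F I (swap I i)) ∧ not z)) pair-exists ⟩
    inSupport I i ∧ (not (feasibleInProjF F I (swap I i)) ∧ false)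
      ≡⟨ cong (inSupport I i ∧_) (BP.∧-zeroʳ _) ⟩
    inSupport I i ∧ false
      ≡⟨ BP.∧-zeroʳ _ ⟩
    false ∎
    where
    pair : Fin n → Bool
    pair j = does (toℕ j N.<? toℕ i) ∧ inSupport I j ∧ feasibleInProjF F I (swap (swap I i) j)
    pair-exists : any pair (Vec.toList (allFin n)) ≡ true
    pair-exists = any-true⁺ pair (∈-allFin j) (∧-true⁺ (Dec.dec-true (toℕ j N.<? toℕ i) j<i) (∧-true⁺ j∈I e))

module _ {n} (F : Family (N.suc n)) where

  -- The new element n is the largest, so it never serves as the smaller partner j of an older element.
  active-∷ʳ-inject₁ : ∀ (H : Family n) I x → (∀ X → feasibleInProjF F (I ∷ʳ x) (X ∷ʳ x) ≡ feasibleInProjF H I X) →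
    ∀ i → activeF F (I ∷ʳ x) (inject₁ i) ≡ activeF H I i
  active-∷ʳ-inject₁ H I x feasible≡ i =
    cong₂ _∧_ (inSupport-∷ʳ-inject₁ I x i)
      (cong₂ _∧_ (cong not (trans (cong (feasibleInProjF F (I ∷ʳ x)) (swap-∷ʳ-inject₁ I x i)) (feasible≡ (swap I i))))
                 (cong not (any-allFin-∷ʳ n _ _ pair≡ last-not-below)))
    where
    pair≡ : ∀ j → (does (toℕ (inject₁ j) N.<? toℕ (inject₁ i)) ∧ inSupport (I ∷ʳ x) (inject₁ j) ∧
                   feasibleInProjF F (I ∷ʳ x) (swap (swap (I ∷ʳ x) (inject₁ i)) (inject₁ j)))
                 ≡ (does (toℕ j N.<? toℕ i) ∧ inSupport I j ∧ feasibleInProjF H I (swap (swap I i) j))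
    pair≡ j = cong₂ _∧_ (cong₂ (λ a b → does (a N.<? b)) (FP.toℕ-inject₁ j) (FP.toℕ-inject₁ i))
      (cong₂ _∧_ (inSupport-∷ʳ-inject₁ I x j)
        (begin
          feasibleInProjF F (I ∷ʳ x) (swap (swap (I ∷ʳ x) (inject₁ i)) (inject₁ j))
            ≡⟨ cong (λ V → feasibleInProjF F (I ∷ʳ x) (swap V (inject₁ j))) (swap-∷ʳ-inject₁ I x i) ⟩
          feasibleInProjF F (I ∷ʳ x) (swap (swap I i ∷ʳ x) (inject₁ j))
            ≡⟨ cong (feasibleInProjF F (I ∷ʳ x)) (swap-∷ʳ-inject₁ (swap I i) x j) ⟩
          feasibleInProjF F (I ∷ʳ x) (swap (swap I i) j ∷ʳ x)
            ≡⟨ feasible≡ (swap (swap I i) j) ⟩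
          feasibleInProjF H I (swap (swap I i) j) ∎))
    last-not-below : (does (toℕ (fromℕ n) N.<? toℕ (inject₁ i)) ∧ _) ≡ false
    last-not-below rewrite FP.toℕ-fromℕ n | FP.toℕ-inject₁ i
      | Dec.dec-false (n N.<? toℕ i) (λ n<i → NP.<-asym n<i (FP.toℕ<n i)) = refl

  activity-∷ʳ : ∀ (H : Family n) I x → (∀ X → feasibleInProjF F (I ∷ʳ x) (X ∷ʳ x) ≡ feasibleInProjF H I X) →
    activityF F (I ∷ʳ x) ≡ activityF H I N.+ 𝟙 (activeF F (I ∷ʳ x) (fromℕ n))
  activity-∷ʳ H I x feasible≡ = trans (count-∷ʳ n (activeF F (I ∷ʳ x)))
    (cong (N._+ 𝟙 (activeF F (I ∷ʳ x) (fromℕ n))) (count-cong n (active-∷ʳ-inject₁ H I x feasible≡)))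

  activity-∷ʳ-nothing : ∀ I → activityF F (I ∷ʳ nothing) ≡ activityF (project F) I
  activity-∷ʳ-nothing I = begin
    activityF F (I ∷ʳ nothing)
      ≡⟨ activity-∷ʳ (project F) I nothing (feasibleInProj-∷ʳ-nothing F I) ⟩
    activityF (project F) I N.+ 𝟙 (activeF F (I ∷ʳ nothing) (fromℕ n))
      ≡⟨ cong (λ z → activityF (project F) I N.+ 𝟙 z) (inactive-outside-support F (I ∷ʳ nothing) (fromℕ n) (inSupport-∷ʳ-last I nothing)) ⟩
    activityF (project F) I N.+ 0
      ≡⟨ NP.+-identityʳ _ ⟩
    activityF (project F) I ∎

  activity-∷ʳ-just : ∀ {G : Family n} {b} → IsFibre G F b → ∀ I →
    activityF F (I ∷ʳ just b) ≡ activityF G I N.+ 𝟙 (activeF F (I ∷ʳ just b) (fromℕ n))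
  activity-∷ʳ-just {G} {b} isFibre I = activity-∷ʳ G I (just b) (feasibleInProj-∷ʳ-just F isFibre b I)

  last-active-if-forced : ∀ b I → Empty (fibre F (not b)) → activeF F (I ∷ʳ just b) (fromℕ n) ≡ true
  last-active-if-forced b I emp
    rewrite inSupport-∷ʳ-last I (just b) | swap-∷ʳ-last I (just b)
          | feasibleInProj-∷ʳ-forbidden F emp b I I = cong not (any-false⁺ _ (Vec.toList (allFin (N.suc n))) no-pair)
    where
    no-pair : ∀ j → (does (toℕ j N.<? toℕ (fromℕ n)) ∧ inSupport (I ∷ʳ just b) j ∧
                      feasibleInProjF F (I ∷ʳ just b) (swap (I ∷ʳ just (not b)) j)) ≡ true → ⊥
    no-pair j e with lastView j | ∧-true⁻ {does (toℕ j N.<? toℕ (fromℕ n))} e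
    ... | last     | below , _ = true≢false (trans (sym below) (Dec.dec-false (n′ N.<? n′) (NP.<-irrefl refl)))
      where n′ = toℕ (fromℕ n)
    ... | inner j′ | _ , rest = true≢false (trans (sym (proj₂ (∧-true⁻ rest)))
            (trans (cong (feasibleInProjF F (I ∷ʳ just b)) (swap-∷ʳ-inject₁ I (just (not b)) j′))
                   (feasibleInProj-∷ʳ-forbidden F emp b I (swap I j′))))

  last-inactive-if-flippable : ∀ b I B → F (B ∷ʳ not b) ≡ true → restrictTo I B ≡ I →
    activeF F (I ∷ʳ just b) (fromℕ n) ≡ false
  last-inactive-if-flippable b I B fB r = inactive-if-flippable F (I ∷ʳ just b) (fromℕ n)
    (subst (λ V → feasibleInProjF F (I ∷ʳ just b) V ≡ true) (sym (swap-∷ʳ-last I (just b)))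
           (feasibleInProj-∷ʳ⁺ F I I (just b) B (not b) fB r))

  -- If the other fibre is non-empty, symmetric exchange flips n either alone or together with
  -- some y < n; inside I̲ that pair-flip is a witness against activity, outside it is invisible.
  last-inactive-if-free : SymmetricExchange F → ∀ b I → independentF F (I ∷ʳ just b) ≡ true →
    Nonempty (fibre F (not b)) → activeF F (I ∷ʳ just b) (fromℕ n) ≡ false
  last-inactive-if-free exchange b I indep (C , fC) with independent-∷ʳ⁻ F I (just b) indep
  ... | B , c , fB , sub , agree with agrees-just⁻ {b} {c} agree
  ...   | refl with exchange-last F exchange B C b fB fC
  ...     | inj₁ fB′ = last-inactive-if-flippable b I B fB′ (subsetB⇒restrictTo≡ I B sub)
  ...     | inj₂ (y , fy) with lookup I y in y∈?
  ...       | nothing = last-inactive-if-flippable b I (flipAt B y) fy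
                          (trans (restrictTo-flipAt-outside I B y y∈?) (subsetB⇒restrictTo≡ I B sub))
  ...       | just _  = inactive-if-pair-flippable F (I ∷ʳ just b) (fromℕ n) (inject₁ y) y<n y∈I pair-flippable
    where
    y<n : toℕ (inject₁ y) N.< toℕ (fromℕ n)
    y<n = subst₂ N._<_ (sym (FP.toℕ-inject₁ y)) (sym (FP.toℕ-fromℕ n)) (FP.toℕ<n y)
    y∈I : inSupport (I ∷ʳ just b) (inject₁ y) ≡ true
    y∈I = trans (inSupport-∷ʳ-inject₁ I (just b) y) (trans (inSupport-lookup I y) (cong Maybe.is-just y∈?))
    swaps≡ : swap (swap (I ∷ʳ just b) (fromℕ n)) (inject₁ y) ≡ swap I y ∷ʳ just (not b)
    swaps≡ = trans (cong (λ V → swap V (inject₁ y)) (swap-∷ʳ-last I (just b))) (swap-∷ʳ-inject₁ I (just (not b)) y)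
    pair-flippable : feasibleInProjF F (I ∷ʳ just b) (swap (swap (I ∷ʳ just b) (fromℕ n)) (inject₁ y)) ≡ true
    pair-flippable = subst (λ V → feasibleInProjF F (I ∷ʳ just b) V ≡ true) (sym swaps≡)
      (feasibleInProj-∷ʳ⁺ F I (swap I y) (just b) (flipAt B y) (not b) fy
        (trans (restrictTo-flipAt I B y) (cong (λ V → swap V y) (subsetB⇒restrictTo≡ I B sub))))

-- Both expansions satisfy the same recursion along the last coordinate

nonempty-or-empty : ∀ {n} (G : Family n) → Nonempty G ⊎ Empty G
nonempty-or-empty {n} G with any G (allFull n) in e
... | true  = inj₁ (any-true⁻ G (allFull n) e)
... | false = inj₂ λ B gB → true≢false (trans (sym (any-true⁺ G (∈-allFull B) gB)) e)

data LastCoordinate {m} (F : Family (N.suc m)) : Set where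
  free   : Nonempty (fibre F false) → Nonempty (fibre F true) → LastCoordinate F
  forced : ∀ b → Nonempty (fibre F b) → Empty (fibre F (not b)) → LastCoordinate F

lastCoordinate : ∀ {m} (F : Family (N.suc m)) → Nonempty F → LastCoordinate F
lastCoordinate F ne with nonempty-or-empty (fibre F false) | nonempty-or-empty (fibre F true)
... | inj₁ nf | inj₁ nt = free nf nt
... | inj₁ nf | inj₂ et = forced false nf et
... | inj₂ ef | inj₁ nt = forced true nt ef
... | inj₂ ef | inj₂ et with ne
...   | B , fB with Vec.initLast B
...     | B′ , false , refl = ⊥-elim (ef B′ fB)
...     | B′ , true  , refl = ⊥-elim (et B′ fB)

+-by-bool : ∀ (f : Bool → ℤ) b → f false + f true ≡ f b + f (not b)
+-by-bool f false = refl
+-by-bool f true  = ZP.+-comm (f false) (f true)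

module Expansion (u v : ℤ) where

  w : ℤ
  w = v - + 1

  rankTerm : ∀ {n} → Family n → AdS n → ℤ
  rankTerm {n} F S = u ^ (n N.∸ card S) * w ^ uExpF F S

  activityTerm : ∀ {n} → Family n → AdS n → ℤ
  activityTerm {n} F I = if independentF F I then u ^ (n N.∸ card I) * v ^ activityF F I else + 0

  rankSum activitySumF : ∀ {n} → Family n → ℤ
  rankSum {n} F = ∑ᴬ n (rankTerm F)
  activitySumF {n} F = ∑ᴬ n (activityTerm F)

  module _ {m} (F : Family (N.suc m)) where

    rankPart activityPart : Maybe Bool → ℤ
    rankPart x = ∑ᴬ m (λ S → rankTerm F (S ∷ʳ x))
    activityPart x = ∑ᴬ m (λ I → activityTerm F (I ∷ʳ x))

    private
      u^-suc : ∀ (S : AdS m) → u ^ (N.suc m N.∸ card S) ≡ u * u ^ (m N.∸ card S)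
      u^-suc S = cong (u ^_) (NP.+-∸-assoc 1 (card≤n S))

      rankTerm-∷ʳ-just : ∀ S b {k} → uExpF F (S ∷ʳ just b) ≡ k → rankTerm F (S ∷ʳ just b) ≡ u ^ (m N.∸ card S) * w ^ k
      rankTerm-∷ʳ-just S b e rewrite card-∷ʳ-just S b | e = refl

      factor-out : ∀ c (f g : AdS m → ℤ) → (∀ S → f S ≡ c * g S) → ∑ᴬ m f ≡ c * ∑ᴬ m g
      factor-out c f g e = trans (∑-cong (allAdS m) e) (∑-*ˡ (allAdS m) c g)

    rankPart-nothing : Nonempty F → rankPart nothing ≡ u * rankSum (project F)
    rankPart-nothing ne = factor-out u _ _ λ S → begin
      u ^ (N.suc m N.∸ card (S ∷ʳ nothing)) * w ^ uExpF F (S ∷ʳ nothing)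
        ≡⟨ cong₂ (λ c k → u ^ (N.suc m N.∸ c) * w ^ k) (card-∷ʳ-nothing S) (uExp-∷ʳ-nothing F S ne) ⟩
      u ^ (N.suc m N.∸ card S) * w ^ uExpF (project F) S
        ≡⟨ cong (_* w ^ uExpF (project F) S) (u^-suc S) ⟩
      u * u ^ (m N.∸ card S) * w ^ uExpF (project F) S
        ≡⟨ ZP.*-assoc u _ _ ⟩
      u * rankTerm (project F) S ∎

    rankPart-free : SymmetricExchange F → ∀ b → Nonempty (fibre F b) → rankPart (just b) ≡ rankSum (fibre F b)
    rankPart-free exchange b nb = ∑-cong (allAdS m) λ S →
      rankTerm-∷ʳ-just S b (uExp-∷ʳ-just F (fibre F b) b (λ _ → refl) S nb (nearby S))
      where
      nearby : ∀ S B → F (B ∷ʳ not b) ≡ true → ∃[ B″ ] (fibre F b B″ ≡ true × distance S B″ N.≤ N.suc (distance S B))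
      nearby S B fB with exchange-last F exchange B (proj₁ nb) (not b) fB
                           (subst (λ c → F (proj₁ nb ∷ʳ c) ≡ true) (sym (BP.not-involutive b)) (proj₂ nb))
      ... | inj₁ f       = B , subst (λ c → F (B ∷ʳ c) ≡ true) (BP.not-involutive b) f , NP.n≤1+n _
      ... | inj₂ (y , f) = flipAt B y , subst (λ c → F (flipAt B y ∷ʳ c) ≡ true) (BP.not-involutive b) f , distance-flipAt S B y

    rankPart-forced : ∀ b → Nonempty (fibre F b) → Empty (fibre F (not b)) → rankPart (just b) ≡ rankSum (project F)
    rankPart-forced b nb eb = ∑-cong (allAdS m) λ S →
      rankTerm-∷ʳ-just S b (uExp-∷ʳ-just F (project F) b (project-isFibre F b eb) S (project-nonempty F b nb)
                                         (λ B fB → ⊥-elim (eb B fB)))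

    rankPart-forbidden : ∀ b → Nonempty (fibre F b) → Empty (fibre F (not b)) → rankPart (just (not b)) ≡ w * rankSum (project F)
    rankPart-forbidden b nb eb = factor-out w _ _ λ S → trans
      (rankTerm-∷ʳ-just S (not b) (uExp-∷ʳ-just-forbidden F (project F) b (project-isFibre F b eb) S (project-nonempty F b nb) eb))
      (factor-comm (u ^ (m N.∸ card S)) (w ^ uExpF (project F) S) w)
      where
      factor-comm : ∀ p q c → p * (c * q) ≡ c * (p * q)
      factor-comm = solve-∀

    activityPart-nothing : activityPart nothing ≡ u * activitySumF (project F)
    activityPart-nothing = factor-out u _ _ term
      where
      term : ∀ I → activityTerm F (I ∷ʳ nothing) ≡ u * activityTerm (project F) I
      term I rewrite independent-∷ʳ-nothing F I | card-∷ʳ-nothing I | activity-∷ʳ-nothing F I | u^-suc I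
        with independentF (project F) I
      ... | true  = ZP.*-assoc u _ _
      ... | false = sym (ZP.*-zeroʳ u)

    private
      activityTerm-∷ʳ-just : ∀ {G : Family m} b → IsFibre G F b → ∀ I → activityTerm F (I ∷ʳ just b) ≡
        (if independentF G I then u ^ (m N.∸ card I) * v ^ (activityF G I N.+ 𝟙 (activeF F (I ∷ʳ just b) (fromℕ m))) else + 0)
      activityTerm-∷ʳ-just b isFibre I rewrite independent-∷ʳ-just F isFibre I | card-∷ʳ-just I b | activity-∷ʳ-just F isFibre I = refl

    activityPart-free : SymmetricExchange F → ∀ b → Nonempty (fibre F (not b)) → activityPart (just b) ≡ activitySumF (fibre F b)
    activityPart-free exchange b nb = ∑-cong (allAdS m) λ I → trans (activityTerm-∷ʳ-just b (λ _ → refl) I) (term I)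
      where
      term : ∀ I → (if independentF (fibre F b) I
                      then u ^ (m N.∸ card I) * v ^ (activityF (fibre F b) I N.+ 𝟙 (activeF F (I ∷ʳ just b) (fromℕ m)))
                      else + 0)
                   ≡ activityTerm (fibre F b) I
      term I with independentF (fibre F b) I in indep
      ... | false = refl
      ... | true rewrite last-inactive-if-free F exchange b I (trans (independent-∷ʳ-just F (λ _ → refl) I) indep) nb
                       | NP.+-identityʳ (activityF (fibre F b) I) = refl

    activityPart-forced : ∀ b → Empty (fibre F (not b)) → activityPart (just b) ≡ v * activitySumF (project F)
    activityPart-forced b eb = factor-out v _ _ λ I → trans (activityTerm-∷ʳ-just b (project-isFibre F b eb) I) (term I)
      where
      term : ∀ I → (if independentF (project F) I
                      then u ^ (m N.∸ card I) * v ^ (activityF (project F) I N.+ 𝟙 (activeF F (I ∷ʳ just b) (fromℕ m)))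
                      else + 0)
                   ≡ v * activityTerm (project F) I
      term I rewrite last-active-if-forced F b I eb with independentF (project F) I
      ... | false = sym (ZP.*-zeroʳ v)
      ... | true  = trans (cong (u ^ (m N.∸ card I) *_) (ZP.^-distribˡ-+-* v (activityF (project F) I) 1))
                          (extra-factor (u ^ (m N.∸ card I)) (v ^ activityF (project F) I) v)
        where
        extra-factor : ∀ p q c → p * (q * (c * + 1)) ≡ c * (p * q)
        extra-factor = solve-∀

    activityPart-forbidden : ∀ c → Empty (fibre F c) → activityPart (just c) ≡ + 0
    activityPart-forbidden c ec = trans (∑-cong (allAdS m) term) (∑-zero (allAdS m))
      where
      term : ∀ I → activityTerm F (I ∷ʳ just c) ≡ + 0
      term I rewrite independent-∷ʳ-forbidden F ec I = refl

    rankSum≡activitySum-free : SymmetricExchange F → Nonempty F → Nonempty (fibre F false) → Nonempty (fibre F true) →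
      (∀ G → SymmetricExchange G → Nonempty G → rankSum G ≡ activitySumF G) → rankSum F ≡ activitySumF F
    rankSum≡activitySum-free exchange ne nf nt induction = begin
      rankSum F
        ≡⟨ ∑ᴬ-∷ʳ m (rankTerm F) ⟩
      rankPart nothing + (rankPart (just false) + rankPart (just true))
        ≡⟨ cong₂ _+_ (rankPart-nothing ne) (cong₂ _+_ (rankPart-free exchange false nf) (rankPart-free exchange true nt)) ⟩
      u * rankSum (project F) + (rankSum (fibre F false) + rankSum (fibre F true))
        ≡⟨ cong₂ _+_ (cong (u *_) (induction (project F) (symmetricExchange-project F exchange) (project-nonempty F false nf)))
                     (cong₂ _+_ (induction (fibre F false) (symmetricExchange-fibre F exchange false) nf)
                                (induction (fibre F true) (symmetricExchange-fibre F exchange true) nt)) ⟩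
      u * activitySumF (project F) + (activitySumF (fibre F false) + activitySumF (fibre F true))
        ≡⟨ cong₂ _+_ activityPart-nothing (cong₂ _+_ (activityPart-free exchange false nt) (activityPart-free exchange true nf)) ⟨
      activityPart nothing + (activityPart (just false) + activityPart (just true))
        ≡⟨ ∑ᴬ-∷ʳ m (activityTerm F) ⟨
      activitySumF F ∎

    -- The projection P is a copy of the only non-empty fibre, and both sides become (u + v) times its value.
    rankSum≡activitySum-forced : SymmetricExchange F → Nonempty F → ∀ b → Nonempty (fibre F b) → Empty (fibre F (not b)) →
      (∀ G → SymmetricExchange G → Nonempty G → rankSum G ≡ activitySumF G) → rankSum F ≡ activitySumF F
    rankSum≡activitySum-forced exchange ne b nb eb induction = begin
      rankSum F
        ≡⟨ ∑ᴬ-∷ʳ m (rankTerm F) ⟩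
      rankPart nothing + (rankPart (just false) + rankPart (just true))
        ≡⟨ cong (λ z → rankPart nothing + z) (+-by-bool (λ c → rankPart (just c)) b) ⟩
      rankPart nothing + (rankPart (just b) + rankPart (just (not b)))
        ≡⟨ cong₂ _+_ (rankPart-nothing ne) (cong₂ _+_ (rankPart-forced b nb eb) (rankPart-forbidden b nb eb)) ⟩
      u * rankSum P + (rankSum P + w * rankSum P)
        ≡⟨ cong (λ z → u * z + (z + w * z)) (induction P (symmetricExchange-project F exchange) (project-nonempty F b nb)) ⟩
      u * activitySumF P + (activitySumF P + w * activitySumF P)
        ≡⟨ u+v-split u v (activitySumF P) ⟩
      u * activitySumF P + (v * activitySumF P + + 0)
        ≡⟨ cong₂ _+_ activityPart-nothing (cong₂ _+_ (activityPart-forced b eb) (activityPart-forbidden (not b) eb)) ⟨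
      activityPart nothing + (activityPart (just b) + activityPart (just (not b)))
        ≡⟨ cong (λ z → activityPart nothing + z) (+-by-bool (λ c → activityPart (just c)) b) ⟨
      activityPart nothing + (activityPart (just false) + activityPart (just true))
        ≡⟨ ∑ᴬ-∷ʳ m (activityTerm F) ⟨
      activitySumF F ∎
      where
      P : Family m
      P = project F
      u+v-split : ∀ u v a → u * a + (a + (v - + 1) * a) ≡ u * a + (v * a + + 0)
      u+v-split = solve-∀

  rankSum≡activitySum : ∀ n (F : Family n) → SymmetricExchange F → Nonempty F → rankSum F ≡ activitySumF F
  rankSum≡activitySum N.zero    F _ ([] , f) rewrite f = refl
  rankSum≡activitySum (N.suc m) F exchange ne with lastCoordinate F ne
  ... | free nf nt     = rankSum≡activitySum-free F exchange ne nf nt (rankSum≡activitySum m)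
  ... | forced b nb eb = rankSum≡activitySum-forced F exchange ne b nb eb (rankSum≡activitySum m)

-- Hamming distance and edge directions

hamming : ∀ {n} → Full n → Full n → ℕ
hamming []      []      = 0
hamming (a ∷ A) (b ∷ B) = mismatch a b N.+ hamming A B

hamming≤n : ∀ {n} (A B : Full n) → hamming A B N.≤ n
hamming≤n []      []      = N.z≤n
hamming≤n (a ∷ A) (b ∷ B) = NP.+-mono-≤ (mismatch≤1 a b) (hamming≤n A B)

hamming≡0⇒≡ : ∀ {n} (A B : Full n) → hamming A B ≡ 0 → B ≡ A
hamming≡0⇒≡ []          []          _ = refl
hamming≡0⇒≡ (false ∷ A) (false ∷ B) e = cong (false ∷_) (hamming≡0⇒≡ A B e)
hamming≡0⇒≡ (true ∷ A)  (true ∷ B)  e = cong (true ∷_) (hamming≡0⇒≡ A B e)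

hamming≢0⇒differ : ∀ {n} (A B : Full n) → hamming A B ≢ 0 → ∃[ y ] lookup A y ≢ lookup B y
hamming≢0⇒differ []      []      h = ⊥-elim (h refl)
hamming≢0⇒differ (a ∷ A) (b ∷ B) h with Bool._≟_ a b
... | no a≢b  = Fin.zero , a≢b
... | yes refl with hamming≢0⇒differ A B h
...   | y , d = Fin.suc y , d

hamming≤1⇒flip : ∀ {n} (A B : Full n) x → lookup A x ≢ lookup B x → hamming A B N.≤ 1 → B ≡ flipAt A x
hamming≤1⇒flip (a ∷ A) (b ∷ B) Fin.zero d h = cong₂ _∷_ (BP.¬-not (λ e → d (sym e)))
  (hamming≡0⇒≡ A B (NP.n≤0⇒n≡0 (NP.≤-pred (subst (λ m → m N.+ hamming A B N.≤ 1) (mismatch-≢ d) h))))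
hamming≤1⇒flip (a ∷ A) (b ∷ B) (Fin.suc x) d h with Bool._≟_ a b
... | yes refl = cong (a ∷_) (hamming≤1⇒flip A B x d h)
... | no _     = ⊥-elim (d (cong (λ V → lookup V x) (sym (hamming≡0⇒≡ A B (NP.n≤0⇒n≡0 (NP.≤-pred h))))))

hamming≤2⇒flips : ∀ {n} (A B : Full n) x → lookup A x ≢ lookup B x → hamming A B N.≤ 2 →
  B ≡ flipAt A x ⊎ ∃[ y ] (y ≢ x × lookup A y ≢ lookup B y × B ≡ flipAt (flipAt A x) y)
hamming≤2⇒flips (a ∷ A) (b ∷ B) Fin.zero d h with hamming A B N.≟ 0
... | yes h≡0 = inj₁ (cong₂ _∷_ (BP.¬-not (λ e → d (sym e))) (hamming≡0⇒≡ A B h≡0))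
... | no h≢0 with hamming≢0⇒differ A B h≢0
...   | y , dy = inj₂ (Fin.suc y , (λ ()) , dy , cong₂ _∷_ (BP.¬-not (λ e → d (sym e)))
                   (hamming≤1⇒flip A B y dy (NP.≤-pred (subst (λ m → m N.+ hamming A B N.≤ 2) (mismatch-≢ d) h))))
hamming≤2⇒flips (a ∷ A) (b ∷ B) (Fin.suc x) d h with Bool._≟_ a b
... | yes refl with hamming≤2⇒flips A B x d h
...   | inj₁ e = inj₁ (cong (a ∷_) e)
...   | inj₂ (y , y≢x , dy , e) = inj₂ (Fin.suc y , (λ s → y≢x (FP.suc-injective s)) , dy , cong (a ∷_) e)
hamming≤2⇒flips (a ∷ A) (b ∷ B) (Fin.suc x) d h | no a≢b =
  inj₂ (Fin.zero , (λ ()) , a≢b , cong₂ _∷_ (BP.¬-not (λ e → a≢b (sym e)))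
    (hamming≤1⇒flip A B x d (NP.≤-pred h)))

isNonzero : ℤ → ℕ
isNonzero z = if does (z ZP.≟ + 0) then 0 else 1

nonzeros : ∀ {n} → Vec ℤ n → ℕ
nonzeros []       = 0
nonzeros (z ∷ zs) = isNonzero z N.+ nonzeros zs

isNonzero≤1 : ∀ z → isNonzero z N.≤ 1
isNonzero≤1 z with does (z ZP.≟ + 0)
... | true  = N.z≤n
... | false = NP.≤-refl

nonzeros-scale : ∀ {p} → p ≢ + 0 → ∀ {n} (d : Vec ℤ n) → nonzeros (Vec.map (p *_) d) ≡ nonzeros d
nonzeros-scale p≢0 []      = refl
nonzeros-scale {p} p≢0 (z ∷ d) = cong₂ N._+_ scale (nonzeros-scale p≢0 d)
  where
  scale : isNonzero (p * z) ≡ isNonzero z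
  scale with z ZP.≟ + 0
  ... | yes refl = cong isNonzero (ZP.*-zeroʳ p)
  ... | no z≢0 = cong (λ t → if t then 0 else 1)
      (Dec.dec-false (p * z ZP.≟ + 0) λ e → [ p≢0 , z≢0 ]′ (ZP.i*j≡0⇒i≡0∨j≡0 p e))

nonzeros-difference : ∀ {n} (A B : Full n) → nonzeros (Vec.zipWith _-_ (eVec A) (eVec B)) ≡ hamming A B
nonzeros-difference []      []      = refl
nonzeros-difference (a ∷ A) (b ∷ B) = cong₂ N._+_ (coordinate a b) (nonzeros-difference A B)
  where
  coordinate : ∀ a b → isNonzero (sgn a - sgn b) ≡ mismatch a b
  coordinate false false = refl
  coordinate false true  = refl
  coordinate true  false = refl
  coordinate true  true  = refl

nonzeros-zipWith : ∀ (f : ℤ → ℤ → ℤ) → f (+ 0) (+ 0) ≡ + 0 → ∀ {n} (s t : Vec ℤ n) →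
  nonzeros (Vec.zipWith f s t) N.≤ nonzeros s N.+ nonzeros t
nonzeros-zipWith f f00 []      []      = N.z≤n
nonzeros-zipWith f f00 (a ∷ s) (b ∷ t) =
  NP.≤-trans (NP.+-mono-≤ coordinate (nonzeros-zipWith f f00 s t))
             (NP.≤-reflexive (+-interchange (isNonzero a) (isNonzero b) (nonzeros s) (nonzeros t)))
  where
  coordinate : isNonzero (f a b) N.≤ isNonzero a N.+ isNonzero b
  coordinate with a ZP.≟ + 0 | b ZP.≟ + 0
  ... | no _     | _        = NP.≤-trans (isNonzero≤1 (f a b)) (N.s≤s N.z≤n)
  ... | yes refl | no _     = isNonzero≤1 (f (+ 0) b)
  ... | yes refl | yes refl = NP.≤-reflexive (cong isNonzero f00)

nonzeros-unit : ∀ {n} (i : Fin n) → nonzeros (unit i) N.≤ 1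
nonzeros-unit {n} i = indicator n (toℕ i)
  where
  zeros : ∀ n (f : Fin n → ℤ) → (∀ k → f k ≡ + 0) → nonzeros (tabulate f) ≡ 0
  zeros N.zero    f h = refl
  zeros (N.suc n) f h = cong₂ N._+_ (cong isNonzero (h Fin.zero)) (zeros n (λ k → f (Fin.suc k)) (λ k → h (Fin.suc k)))
  indicator : ∀ n m → nonzeros (tabulate {n = n} (λ k → if does (toℕ k N.≟ m) then + 1 else + 0)) N.≤ 1
  indicator N.zero    m         = N.z≤n
  indicator (N.suc n) N.zero    = NP.≤-reflexive (cong N.suc (zeros n _ (λ k → refl)))
  indicator (N.suc n) (N.suc m) = indicator n m

nonzeros-root : ∀ {n} (w : Vec ℤ n) → IsRootDirection w → nonzeros w N.≤ 2
nonzeros-root w (inj₁ (i , refl)) = NP.m≤n⇒m≤1+n (nonzeros-unit i)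
nonzeros-root w (inj₂ (inj₁ (i , j , _ , refl))) =
  NP.≤-trans (nonzeros-zipWith _+_ refl (unit i) (unit j)) (NP.+-mono-≤ (nonzeros-unit i) (nonzeros-unit j))
nonzeros-root w (inj₂ (inj₂ (i , j , _ , refl))) =
  NP.≤-trans (nonzeros-zipWith _-_ refl (unit i) (unit j)) (NP.+-mono-≤ (nonzeros-unit i) (nonzeros-unit j))

root-parallel⇒hamming≤2 : ∀ {n} (A B : Full n) w → IsRootDirection w →
  Parallel (Vec.zipWith _-_ (eVec A) (eVec B)) w → hamming A B N.≤ 2
root-parallel⇒hamming≤2 {n} A B w root (p , q , p≢0 , q≢0 , scaled) = subst (N._≤ 2) same-support (nonzeros-root w root)
  where
  d : Vec ℤ n
  d = Vec.zipWith _-_ (eVec A) (eVec B)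
  same-support : nonzeros w ≡ hamming A B
  same-support = begin
    nonzeros w                    ≡⟨ nonzeros-scale q≢0 w ⟨
    nonzeros (Vec.map (q *_) w)   ≡⟨ cong nonzeros scaled ⟨
    nonzeros (Vec.map (p *_) d)   ≡⟨ nonzeros-scale p≢0 d ⟩
    nonzeros d                    ≡⟨ nonzeros-difference A B ⟩
    hamming A B                   ∎

-- A linear functional exposing a given pair of vertices

signedBy : ∀ {n} → Full n → Vec ℤ n → Vec ℤ n
signedBy []      []       = []
signedBy (a ∷ A) (ω ∷ ωs) = sgn a * ω ∷ signedBy A ωs

differenceWeight : ∀ {n} → Vec ℤ n → Full n → Full n → ℤ
differenceWeight []       []      []      = + 0
differenceWeight (ω ∷ ωs) (a ∷ A) (b ∷ B) = (if does (Bool._≟_ a b) then + 0 else ω) + differenceWeight ωs A B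

dot-signedBy : ∀ {n} (ω : Vec ℤ n) A B →
  dot (signedBy A ω) (eVec A) - dot (signedBy A ω) (eVec B) ≡ + 2 * differenceWeight ω A B
dot-signedBy []       []      []      = refl
dot-signedBy (ω ∷ ωs) (a ∷ A) (b ∷ B) = begin
  (c * sgn a + dot (signedBy A ωs) (eVec A)) - (c * sgn b + dot (signedBy A ωs) (eVec B))
    ≡⟨ regroup (c * sgn a) (c * sgn b) (dot (signedBy A ωs) (eVec A)) (dot (signedBy A ωs) (eVec B)) ⟩
  (c * sgn a - c * sgn b) + (dot (signedBy A ωs) (eVec A) - dot (signedBy A ωs) (eVec B))
    ≡⟨ cong₂ _+_ (coordinate a b ω) (dot-signedBy ωs A B) ⟩
  + 2 * (if does (Bool._≟_ a b) then + 0 else ω) + + 2 * differenceWeight ωs A B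
    ≡⟨ ZP.*-distribˡ-+ (+ 2) (if does (Bool._≟_ a b) then + 0 else ω) (differenceWeight ωs A B) ⟨
  + 2 * differenceWeight (ω ∷ ωs) (a ∷ A) (b ∷ B) ∎
  where
  c = sgn a * ω
  regroup : ∀ x y p q → (x + p) - (y + q) ≡ (x - y) + (p - q)
  regroup = solve-∀
  coordinate : ∀ a b ω → sgn a * ω * sgn a - sgn a * ω * sgn b ≡ + 2 * (if does (Bool._≟_ a b) then + 0 else ω)
  coordinate false false ω = ZP.+-inverseʳ (sgn false * ω * sgn false)
  coordinate false true  ω = negative-first ω
    where
    negative-first : ∀ ω → - + 1 * ω * - + 1 - - + 1 * ω * + 1 ≡ + 2 * ω
    negative-first = solve-∀
  coordinate true  false ω = positive-first ω
    where
    positive-first : ∀ ω → + 1 * ω * + 1 - + 1 * ω * - + 1 ≡ + 2 * ω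
    positive-first = solve-∀
  coordinate true  true  ω = ZP.+-inverseʳ (sgn true * ω * sgn true)

exposingWeight : ℤ → ℤ → Bool → Bool → Bool → ℤ
exposingWeight W κ a b′ marked = if does (Bool._≟_ a b′) then W else (if marked then + 1 - κ else + 1)

exposingWeights : ∀ {n} → ℤ → ℤ → Full n → Full n → Vec Bool n → Vec ℤ n
exposingWeights W κ []      []        []       = []
exposingWeights W κ (a ∷ A) (b′ ∷ B′) (χ ∷ X) = exposingWeight W κ a b′ χ ∷ exposingWeights W κ A B′ X

CoordinateTest : Set
CoordinateTest = Bool → Bool → Bool → Bool → ℕ

countCoordinates : ∀ {n} → CoordinateTest → Full n → Full n → Vec Bool n → Full n → ℕ
countCoordinates t []      []        []      []      = 0
countCoordinates t (a ∷ A) (b′ ∷ B′) (χ ∷ X) (b ∷ B) = t a b′ χ b N.+ countCoordinates t A B′ X B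

-- Tests for i ∈ Δ(A,B) \ Δ(A,B′), for i ∈ Δ(A,B) ∩ Δ(A,B′), and for the latter at a marked i,
-- where a, b′, b are the i-th entries of A, B′, B.
newFlip sharedFlip markedFlip : CoordinateTest
newFlip    a b′ χ b = if does (Bool._≟_ a b) then 0 else (if does (Bool._≟_ a b′) then 1 else 0)
sharedFlip a b′ χ b = if does (Bool._≟_ a b) then 0 else (if does (Bool._≟_ a b′) then 0 else 1)
markedFlip a b′ χ b = if does (Bool._≟_ a b) then 0 else (if does (Bool._≟_ a b′) then 0 else (if χ then 1 else 0))

differenceWeight-exposing : ∀ {n} W κ (A B′ : Full n) X B →
  differenceWeight (exposingWeights W κ A B′ X) A B
    ≡ W * + countCoordinates newFlip A B′ X B + + countCoordinates sharedFlip A B′ X B - κ * + countCoordinates markedFlip A B′ X B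
differenceWeight-exposing W κ []      []        []      []      = solve-∀′ W κ
  where
  solve-∀′ : ∀ W κ → + 0 ≡ W * + 0 + + 0 - κ * + 0
  solve-∀′ = solve-∀
differenceWeight-exposing W κ (a ∷ A) (b′ ∷ B′) (χ ∷ X) (b ∷ B) =
  trans (cong₂ _+_ (coordinate a b′ χ b) (differenceWeight-exposing W κ A B′ X B))
        (collect W κ (+ newFlip a b′ χ b) (+ sharedFlip a b′ χ b) (+ markedFlip a b′ χ b)
                 (+ countCoordinates newFlip A B′ X B) (+ countCoordinates sharedFlip A B′ X B) (+ countCoordinates markedFlip A B′ X B))
  where
  collect : ∀ W κ p q r p′ q′ r′ → (W * p + q - κ * r) + (W * p′ + q′ - κ * r′) ≡ W * (p + p′) + (q + q′) - κ * (r + r′)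
  collect = solve-∀
  zero-weight : ∀ W κ → + 0 ≡ W * + 0 + + 0 - κ * + 0
  zero-weight = solve-∀
  new-weight : ∀ W κ → W ≡ W * + 1 + + 0 - κ * + 0
  new-weight = solve-∀
  shared-weight : ∀ W κ → + 1 ≡ W * + 0 + + 1 - κ * + 0
  shared-weight = solve-∀
  marked-weight : ∀ W κ → + 1 - κ ≡ W * + 0 + + 1 - κ * + 1
  marked-weight = solve-∀
  coordinate : ∀ a b′ χ b → (if does (Bool._≟_ a b) then + 0 else exposingWeight W κ a b′ χ)
    ≡ W * + newFlip a b′ χ b + + sharedFlip a b′ χ b - κ * + markedFlip a b′ χ b
  coordinate false false false false = zero-weight W κ
  coordinate false false false true  = new-weight W κ
  coordinate false false true  false = zero-weight W κ
  coordinate false false true  true  = new-weight W κ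
  coordinate false true  false false = zero-weight W κ
  coordinate false true  false true  = shared-weight W κ
  coordinate false true  true  false = zero-weight W κ
  coordinate false true  true  true  = marked-weight W κ
  coordinate true  false false false = shared-weight W κ
  coordinate true  false false true  = zero-weight W κ
  coordinate true  false true  false = marked-weight W κ
  coordinate true  false true  true  = zero-weight W κ
  coordinate true  true  false false = new-weight W κ
  coordinate true  true  false true  = zero-weight W κ
  coordinate true  true  true  false = new-weight W κ
  coordinate true  true  true  true  = zero-weight W κ

module _ {n} (A B′ : Full n) (X : Vec Bool n) where

  newFlips sharedFlips markedFlips : Full n → ℕ
  newFlips    = countCoordinates newFlip A B′ X
  sharedFlips = countCoordinates sharedFlip A B′ X
  markedFlips = countCoordinates markedFlip A B′ X

hamming-split : ∀ {n} (A B′ : Full n) X B → hamming A B ≡ newFlips A B′ X B N.+ sharedFlips A B′ X B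
hamming-split []      []        []      []      = refl
hamming-split (a ∷ A) (b′ ∷ B′) (χ ∷ X) (b ∷ B) =
  trans (cong₂ N._+_ (coordinate a b′ b) (hamming-split A B′ X B)) (+-interchange (newFlip a b′ χ b) (sharedFlip a b′ χ b) _ _)
  where
  coordinate : ∀ a b′ b → mismatch a b ≡ newFlip a b′ χ b N.+ sharedFlip a b′ χ b
  coordinate false false false = refl
  coordinate false false true  = refl
  coordinate false true  false = refl
  coordinate false true  true  = refl
  coordinate true  false false = refl
  coordinate true  false true  = refl
  coordinate true  true  false = refl
  coordinate true  true  true  = refl

sharedFlip≤mismatch : ∀ a b′ χ b → sharedFlip a b′ χ b N.≤ mismatch a b′
sharedFlip≤mismatch false false χ false = N.z≤n
sharedFlip≤mismatch false false χ true  = N.z≤n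
sharedFlip≤mismatch false true  χ false = N.z≤n
sharedFlip≤mismatch false true  χ true  = N.s≤s N.z≤n
sharedFlip≤mismatch true  false χ false = N.s≤s N.z≤n
sharedFlip≤mismatch true  false χ true  = N.z≤n
sharedFlip≤mismatch true  true  χ false = N.z≤n
sharedFlip≤mismatch true  true  χ true  = N.z≤n

sharedFlips≤hamming : ∀ {n} (A B′ : Full n) X B → sharedFlips A B′ X B N.≤ hamming A B′
sharedFlips≤hamming []      []        []      []      = N.z≤n
sharedFlips≤hamming (a ∷ A) (b′ ∷ B′) (χ ∷ X) (b ∷ B) = NP.+-mono-≤ (sharedFlip≤mismatch a b′ χ b) (sharedFlips≤hamming A B′ X B)

newFlips≡0⇒within : ∀ {n} (A B′ : Full n) X B → newFlips A B′ X B ≡ 0 → ∀ i → lookup B i ≢ lookup A i → lookup B′ i ≢ lookup A i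
newFlips≡0⇒within (a ∷ A) (b′ ∷ B′) (χ ∷ X) (b ∷ B) e Fin.zero    = coordinate a b′ b (NP.m+n≡0⇒m≡0 (newFlip a b′ χ b) e)
  where
  coordinate : ∀ a b′ b → newFlip a b′ χ b ≡ 0 → b ≢ a → b′ ≢ a
  coordinate false false false _ b≢a _ = b≢a refl
  coordinate false true  false _ b≢a _ = b≢a refl
  coordinate true  false true  _ b≢a _ = b≢a refl
  coordinate true  true  true  _ b≢a _ = b≢a refl
  coordinate false true  true  _ _ ()
  coordinate true  false false _ _ ()
  coordinate false false true  () _
  coordinate true  true  false () _
newFlips≡0⇒within (a ∷ A) (b′ ∷ B′) (χ ∷ X) (b ∷ B) e (Fin.suc i) = newFlips≡0⇒within A B′ X B (NP.m+n≡0⇒n≡0 (newFlip a b′ χ b) e) i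

+-≤-≡⇒≡ : ∀ {p q r s} → p N.≤ q → r N.≤ s → p N.+ r ≡ q N.+ s → p ≡ q × r ≡ s
+-≤-≡⇒≡ {p} {q} {r} {s} p≤q r≤s e with NP.m≤n⇒m<n∨m≡n p≤q
... | inj₂ refl = refl , NP.+-cancelˡ-≡ p r s e
... | inj₁ p<q  = ⊥-elim (NP.<-irrefl e (NP.+-mono-<-≤ p<q r≤s))

exposed-≡ : ∀ {n} (A B′ : Full n) X B → newFlips A B′ X B ≡ 0 → sharedFlips A B′ X B ≡ hamming A B′ → B ≡ B′
exposed-≡ []      []        []      []      _ _ = refl
exposed-≡ (a ∷ A) (b′ ∷ B′) (χ ∷ X) (b ∷ B) new shared with +-≤-≡⇒≡ (sharedFlip≤mismatch a b′ χ b) (sharedFlips≤hamming A B′ X B) shared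
... | head≡ , tail≡ = cong₂ _∷_ (coordinate a b′ b (NP.m+n≡0⇒m≡0 (newFlip a b′ χ b) new) head≡)
                                (exposed-≡ A B′ X B (NP.m+n≡0⇒n≡0 (newFlip a b′ χ b) new) tail≡)
  where
  coordinate : ∀ a b′ b → newFlip a b′ χ b ≡ 0 → sharedFlip a b′ χ b ≡ mismatch a b′ → b ≡ b′
  coordinate false false false _  _  = refl
  coordinate false true  true  _  _  = refl
  coordinate true  false false _  _  = refl
  coordinate true  true  true  _  _  = refl
  coordinate false false true  () _
  coordinate true  true  false () _
  coordinate false true  false _  ()
  coordinate true  false true  _  ()

newFlips-self : ∀ {n} (A B′ : Full n) X → newFlips A B′ X B′ ≡ 0
newFlips-self []      []        []      = refl
newFlips-self (a ∷ A) (b′ ∷ B′) (χ ∷ X) = trans (cong (N._+ newFlips A B′ X B′) (coordinate a b′)) (newFlips-self A B′ X)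
  where
  coordinate : ∀ a b′ → newFlip a b′ χ b′ ≡ 0
  coordinate false false = refl
  coordinate false true  = refl
  coordinate true  false = refl
  coordinate true  true  = refl

sharedFlips-self : ∀ {n} (A B′ : Full n) X → sharedFlips A B′ X B′ ≡ hamming A B′
sharedFlips-self []      []        []      = refl
sharedFlips-self (a ∷ A) (b′ ∷ B′) (χ ∷ X) = cong₂ N._+_ (coordinate a b′) (sharedFlips-self A B′ X)
  where
  coordinate : ∀ a b′ → sharedFlip a b′ χ b′ ≡ mismatch a b′
  coordinate false false = refl
  coordinate false true  = refl
  coordinate true  false = refl
  coordinate true  true  = refl

markAt : ∀ {n} → Fin n → Vec Bool n
markAt {N.suc n} Fin.zero    = true ∷ Vec.replicate n false
markAt           (Fin.suc i) = false ∷ markAt i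

markedFlip-unmarked : ∀ a b′ b → markedFlip a b′ false b ≡ 0
markedFlip-unmarked a b′ b with does (Bool._≟_ a b) | does (Bool._≟_ a b′)
... | true  | _     = refl
... | false | true  = refl
... | false | false = refl

markedFlips-unmarked : ∀ {n} (A B′ B : Full n) → markedFlips A B′ (Vec.replicate n false) B ≡ 0
markedFlips-unmarked []      []        []      = refl
markedFlips-unmarked (a ∷ A) (b′ ∷ B′) (b ∷ B) =
  trans (cong (N._+ markedFlips A B′ _ B) (markedFlip-unmarked a b′ b)) (markedFlips-unmarked A B′ B)

markedFlips-markAt : ∀ {n} (A B′ B : Full n) x →
  markedFlips A B′ (markAt x) B ≡ markedFlip (lookup A x) (lookup B′ x) true (lookup B x)
markedFlips-markAt (a ∷ A) (b′ ∷ B′) (b ∷ B) Fin.zero    =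
  trans (cong (markedFlip a b′ true b N.+_) (markedFlips-unmarked A B′ B)) (NP.+-identityʳ _)
markedFlips-markAt (a ∷ A) (b′ ∷ B′) (b ∷ B) (Fin.suc x) =
  trans (cong (N._+ markedFlips A B′ (markAt x) B) (markedFlip-unmarked a b′ b)) (markedFlips-markAt A B′ B x)

-- Edges of the feasible polytope give symmetric exchange

FlipsWithin : ∀ {n} → Full n → Full n → Full n → Set
FlipsWithin A B C = ∀ i → lookup B i ≢ lookup A i → lookup C i ≢ lookup A i

flipsWithin : ∀ {n} → Full n → Full n → Full n → Bool
flipsWithin []      []      []      = true
flipsWithin (a ∷ A) (b ∷ B) (c ∷ C) = (does (Bool._≟_ b a) ∨ not (does (Bool._≟_ c a))) ∧ flipsWithin A B C

flipsWithin⁻ : ∀ {n} (A B C : Full n) → flipsWithin A B C ≡ true → FlipsWithin A B C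
flipsWithin⁻ (a ∷ A) (b ∷ B) (c ∷ C) e Fin.zero b≢a c≡a with ∧-true⁻ {does (Bool._≟_ b a) ∨ not (does (Bool._≟_ c a))} e
... | coordinate , _ rewrite Dec.dec-false (Bool._≟_ b a) b≢a | Dec.dec-true (Bool._≟_ c a) c≡a = true≢false (sym coordinate)
flipsWithin⁻ (a ∷ A) (b ∷ B) (c ∷ C) e (Fin.suc i) = flipsWithin⁻ A B C (proj₂ (∧-true⁻ {does (Bool._≟_ b a) ∨ _} e)) i

flipsWithin⁺ : ∀ {n} (A B C : Full n) → FlipsWithin A B C → flipsWithin A B C ≡ true
flipsWithin⁺ []      []      []      _ = refl
flipsWithin⁺ (a ∷ A) (b ∷ B) (c ∷ C) h = ∧-true⁺ coordinate (flipsWithin⁺ A B C (λ i → h (Fin.suc i)))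
  where
  coordinate : (does (Bool._≟_ b a) ∨ not (does (Bool._≟_ c a))) ≡ true
  coordinate with Bool._≟_ b a
  ... | yes _   = refl
  ... | no b≢a  = cong not (Dec.dec-false (Bool._≟_ c a) (h Fin.zero b≢a))

module Exchange {n} (F : Family n) (A C : Full n) (x : Fin n) where

  Candidate : Full n → Set
  Candidate B = F B ≡ true × lookup B x ≢ lookup A x × FlipsWithin A B C

  isCandidate : Full n → Bool
  isCandidate B = F B ∧ not (does (Bool._≟_ (lookup B x) (lookup A x))) ∧ flipsWithin A B C

  isCandidate⁻ : ∀ B → isCandidate B ≡ true → Candidate B
  isCandidate⁻ B e with ∧-true⁻ {F B} e
  ... | fB , rest with ∧-true⁻ {not (does (Bool._≟_ (lookup B x) (lookup A x)))} rest
  ...   | differs , within = fB , (λ eq → true≢false (trans (sym differs) (cong not (Dec.dec-true (Bool._≟_ _ _) eq)))) ,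
                              flipsWithin⁻ A B C within

  isCandidate⁺ : ∀ B → Candidate B → isCandidate B ≡ true
  isCandidate⁺ B (fB , differs , within) =
    ∧-true⁺ fB (∧-true⁺ (cong not (Dec.dec-false (Bool._≟_ _ _) differs)) (flipsWithin⁺ A B C within))

  closest : Candidate C → ∃[ B′ ] (Candidate B′ × (∀ B → Candidate B → hamming A B′ N.≤ hamming A B))
  closest cC = B′ , isCandidate⁻ B′ B′-candidate , minimal
    where
    candidates : List (Full n)
    candidates = filter (λ B → Bool._≟_ (isCandidate B) true) (allFull n)
    B′ : Full n
    B′ = argmin (hamming A) C candidates
    B′-candidate : isCandidate B′ ≡ true
    B′-candidate = argmin-all (hamming A) {P = λ B → isCandidate B ≡ true} (isCandidate⁺ C cC)
                              (all-filter (λ B → Bool._≟_ (isCandidate B) true) (allFull n))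
    minimal : ∀ B → Candidate B → hamming A B′ N.≤ hamming A B
    minimal B cB = All.lookup (f[argmin]≤f[xs] C candidates)
                              (∈-filter⁺ (λ B → Bool._≟_ (isCandidate B) true) (∈-allFull B) (isCandidate⁺ B cB))

  -- The functional c with c_i = ± W off Δ(A,B′), ± 1 on Δ(A,B′) \ {x} and ± (1 - k) at x, where
  -- k = |Δ(A,B′)|, is maximised over the feasible sets exactly at A and a closest candidate B′.
  module Exposed (B′ : Full n) (cB′ : Candidate B′) (minimal : ∀ B → Candidate B → hamming A B′ N.≤ hamming A B) where

    k : ℕ
    k = hamming A B′

    c : Vec ℤ n
    c = signedBy A (exposingWeights (+ N.suc n) (+ k) A B′ (markAt x))

    hi lo : Full n → ℕ
    hi B = N.suc n N.* newFlips A B′ (markAt x) B N.+ sharedFlips A B′ (markAt x) B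
    lo B = k N.* markedFlips A B′ (markAt x) B

    private
      B′x≢Ax : lookup B′ x ≢ lookup A x
      B′x≢Ax = proj₁ (proj₂ cB′)

    marked≡ : ∀ B → markedFlips A B′ (markAt x) B ≡ mismatch (lookup A x) (lookup B x)
    marked≡ B = trans (markedFlips-markAt A B′ B x) (at-x (lookup A x) (lookup B′ x) (lookup B x) B′x≢Ax)
      where
      at-x : ∀ a b′ b → b′ ≢ a → markedFlip a b′ true b ≡ mismatch a b
      at-x a b′ b b′≢a rewrite Dec.dec-false (Bool._≟_ a b′) (λ e → b′≢a (sym e)) = refl

    lo≤k : ∀ B → lo B N.≤ k
    lo≤k B = NP.≤-trans (NP.*-monoʳ-≤ k (subst (N._≤ 1) (sym (marked≡ B)) (mismatch≤1 (lookup A x) (lookup B x)))) (NP.≤-reflexive (NP.*-identityʳ k))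

    balance-new : ∀ B → newFlips A B′ (markAt x) B ≢ 0 → lo B N.< hi B
    balance-new B new≢0 = NP.≤-<-trans (NP.≤-trans (lo≤k B) (hamming≤n A B′))
      (NP.<-≤-trans (NP.n<1+n n) (NP.≤-trans (NP.m≤m*n (N.suc n) (newFlips A B′ (markAt x) B) {{N.≢-nonZero new≢0}}) (NP.m≤m+n _ _)))

    hi-without-new : ∀ B → newFlips A B′ (markAt x) B ≡ 0 → hi B ≡ sharedFlips A B′ (markAt x) B
    hi-without-new B new≡0 = cong (N._+ sharedFlips A B′ (markAt x) B) (trans (cong (N.suc n N.*_) new≡0) (NP.*-zeroʳ (N.suc n)))

    balance-unmoved : ∀ B → newFlips A B′ (markAt x) B ≡ 0 → lookup B x ≡ lookup A x → lo B ≡ 0 × (hi B ≡ lo B → B ≡ A)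
    balance-unmoved B new≡0 Bx≡Ax = lo≡0 , λ hi≡lo → hamming≡0⇒≡ A B (begin
      hamming A B                                              ≡⟨ hamming-split A B′ (markAt x) B ⟩
      newFlips A B′ (markAt x) B N.+ sharedFlips A B′ (markAt x) B ≡⟨ cong (N._+ sharedFlips A B′ (markAt x) B) new≡0 ⟩
      sharedFlips A B′ (markAt x) B                            ≡⟨ hi-without-new B new≡0 ⟨
      hi B                                                     ≡⟨ hi≡lo ⟩
      lo B                                                     ≡⟨ lo≡0 ⟩
      0                                                        ∎)
      where
      lo≡0 : lo B ≡ 0
      lo≡0 = trans (cong (k N.*_) (trans (marked≡ B) (trans (cong (mismatch (lookup A x)) Bx≡Ax) (mismatch-refl (lookup A x))))) (NP.*-zeroʳ k)

    balance-moved : ∀ B → F B ≡ true → newFlips A B′ (markAt x) B ≡ 0 → lookup B x ≢ lookup A x → hi B ≡ lo B × B ≡ B′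
    balance-moved B fB new≡0 Bx≢Ax = hi≡lo , exposed-≡ A B′ (markAt x) B new≡0 shared≡k
      where
      within : FlipsWithin A B C
      within i d = proj₂ (proj₂ cB′) i (newFlips≡0⇒within A B′ (markAt x) B new≡0 i d)
      hamming≡shared : hamming A B ≡ sharedFlips A B′ (markAt x) B
      hamming≡shared = trans (hamming-split A B′ (markAt x) B) (cong (N._+ sharedFlips A B′ (markAt x) B) new≡0)
      shared≡k : sharedFlips A B′ (markAt x) B ≡ k
      shared≡k = NP.≤-antisym (sharedFlips≤hamming A B′ (markAt x) B)
                              (subst (k N.≤_) hamming≡shared (minimal B (fB , Bx≢Ax , within)))
      hi≡lo : hi B ≡ lo B
      hi≡lo = begin
        hi B ≡⟨ trans (hi-without-new B new≡0) shared≡k ⟩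
        k ≡⟨ NP.*-identityʳ k ⟨
        k N.* 1
          ≡⟨ cong (k N.*_) (trans (marked≡ B) (mismatch-≢ (λ e → Bx≢Ax (sym e)))) ⟨
        lo B ∎

    balance : ∀ B → F B ≡ true → lo B N.≤ hi B × (hi B ≡ lo B → B ≡ A ⊎ B ≡ B′)
    balance B fB with newFlips A B′ (markAt x) B N.≟ 0 | Bool._≟_ (lookup B x) (lookup A x)
    ... | no new≢0 | _ = NP.<⇒≤ (balance-new B new≢0) , λ hi≡lo → ⊥-elim (NP.<⇒≢ (balance-new B new≢0) (sym hi≡lo))
    ... | yes new≡0 | yes Bx≡Ax = subst (N._≤ hi B) (sym (proj₁ (balance-unmoved B new≡0 Bx≡Ax))) N.z≤n ,
                                  λ hi≡lo → inj₁ (proj₂ (balance-unmoved B new≡0 Bx≡Ax) hi≡lo)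
    ... | yes new≡0 | no Bx≢Ax  = NP.≤-reflexive (sym (proj₁ (balance-moved B fB new≡0 Bx≢Ax))) ,
                                  λ _ → inj₂ (proj₂ (balance-moved B fB new≡0 Bx≢Ax))

    gap : ∀ B → dot c (eVec A) - dot c (eVec B) ≡ + 2 * (+ hi B - + lo B)
    gap B = trans (dot-signedBy _ A B) (cong (+ 2 *_) (trans (differenceWeight-exposing (+ N.suc n) (+ k) A B′ (markAt x) B)
                  (cong₂ (λ p q → p + + sharedFlips A B′ (markAt x) B - q)
                         (sym (ZP.pos-* (N.suc n) _)) (sym (ZP.pos-* k _)))))

    gap≥0 : ∀ B → F B ≡ true → dot c (eVec B) Z.≤ dot c (eVec A)
    gap≥0 B fB = ZP.0≤i-j⇒j≤i (subst (+ 0 Z.≤_) (sym (gap B))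
                   (ZP.*-monoˡ-≤-nonNeg (+ 2) (ZP.i≤j⇒0≤j-i (Z.+≤+ (proj₁ (balance B fB))))))

    gap≡0⇒hi≡lo : ∀ B → dot c (eVec B) ≡ dot c (eVec A) → hi B ≡ lo B
    gap≡0⇒hi≡lo B e with ZP.i*j≡0⇒i≡0∨j≡0 (+ 2) (trans (sym (gap B)) (ZP.i≡j⇒i-j≡0 (sym e)))
    ... | inj₂ d≡0 = ZP.+-injective (ZP.i-j≡0⇒i≡j _ _ d≡0)

    hi≡lo-at-B′ : hi B′ ≡ lo B′
    hi≡lo-at-B′ = begin
      N.suc n N.* newFlips A B′ (markAt x) B′ N.+ sharedFlips A B′ (markAt x) B′
        ≡⟨ cong₂ (λ p q → N.suc n N.* p N.+ q) (newFlips-self A B′ (markAt x)) (sharedFlips-self A B′ (markAt x)) ⟩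
      N.suc n N.* 0 N.+ k
        ≡⟨ cong (N._+ k) (NP.*-zeroʳ (N.suc n)) ⟩
      k ≡⟨ NP.*-identityʳ k ⟨
      k N.* 1
        ≡⟨ cong (k N.*_) (trans (marked≡ B′) (mismatch-≢ (λ e → B′x≢Ax (sym e)))) ⟨
      lo B′ ∎

    exposed-edge : F A ≡ true → IsEdge F A B′
    exposed-edge fA = fA , proj₁ cB′ , (λ A≡B′ → B′x≢Ax (cong (λ V → lookup V x) (sym A≡B′))) ,
      c , gap≥0 , dot-at-B′ , λ B fB e → proj₂ (balance B fB) (gap≡0⇒hi≡lo B e)
      where
      dot-at-B′ : dot c (eVec B′) ≡ dot c (eVec A)
      dot-at-B′ = sym (ZP.i-j≡0⇒i≡j _ _ (trans (gap B′) (cong (λ d → + 2 * d) (ZP.i≡j⇒i-j≡0 (cong +_ hi≡lo-at-B′)))))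

  exchange : F A ≡ true → F C ≡ true → lookup A x ≢ lookup C x →
    (∀ B′ → IsEdge F A B′ → ∃[ w ] (IsRootDirection w × Parallel (Vec.zipWith _-_ (eVec A) (eVec B′)) w)) →
    F (flipAt A x) ≡ true ⊎ ∃[ y ] (y ≢ x × lookup A y ≢ lookup C y × F (flipAt (flipAt A x) y) ≡ true)
  exchange fA fC Ax≢Cx edges with closest (fC , (λ e → Ax≢Cx (sym e)) , λ i d → d)
  ... | B′ , cB′@(fB′ , B′x≢Ax , within) , minimal with edges B′ (Exposed.exposed-edge B′ cB′ minimal fA)
  ...   | w , root , parallel with hamming≤2⇒flips A B′ x (λ e → B′x≢Ax (sym e)) (root-parallel⇒hamming≤2 A B′ w root parallel)
  ...     | inj₁ B′≡ = inj₁ (subst (λ V → F V ≡ true) B′≡ fB′)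
  ...     | inj₂ (y , y≢x , Ay≢B′y , B′≡) =
            inj₂ (y , y≢x , (λ e → within y (λ e′ → Ay≢B′y (sym e′)) (sym e)) , subst (λ V → F V ≡ true) B′≡ fB′)

symmetricExchange : ∀ {n} (D : DeltaMatroid n) → SymmetricExchange (feasible D)
symmetricExchange D A C fA fC x Ax≢Cx = Exchange.exchange (feasible D) A C x fA fC Ax≢Cx (edges D A)

theorem3p8 : (n : ℕ) (D : DeltaMatroid n) (u v : ℤ) →
    U D u (v - + 1) ≡ activitySum D u v
theorem3p8 n D u v = begin
  U D u (v - + 1)
    ≡⟨ rankSum≡activitySum n (feasible D) (symmetricExchange D) (nonempty D) ⟩
  ∑ᴬ n (activityTerm (feasible D))
    ≡⟨ ∑-filter (allAdS n) (independentF (feasible D)) (λ I → u ^ (n N.∸ card I) * v ^ activityF (feasible D) I) ⟨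
  activitySum D u v ∎
  where open Expansion u v
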